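{- Let $\Gamma$ be either $\Sigma^1_1$ or $\Pi^1_0$. Over $\mathsf{RCA}_0$ the following three schemes are equivalent: (1) $\forall X\exists! Y\varphi(X,Y)\rightarrow\exists Y\forall n\,\varphi(Y^n,Y_n)$ for $\varphi\in\Gamma$; (2) $\forall X\exists! Y\theta(X,Y)\rightarrow\forall A\,\exists Y\big(Y_0=A\wedge\forall n\,\theta(Y_n,Y_{n+1})\big)$ for $\theta\in\Gamma$; (3) $\forall n\forall X\exists! Y\psi(n,X,Y)\rightarrow\forall A\,\exists Y\big(Y_0=A\wedge\forall n\,\psi(n,Y_n,Y_{n+1})\big)$ for $\psi\in\Gamma$.
   Context: Second-order arithmetic; $\Pi^1_0$ = arithmetical formulas. Schemes allow parameters and consist of universal closures. Fix a pairing $\langle\cdot,\cdot\rangle$; $Y_n=\{x:\langle x,n\rangle\in Y\}$ and $Y^n=\{\langle x,l\rangle : x\in Y_l,\ l<n\}$. -}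

module Defs where

-- Semantic framework for second-order arithmetic (L_2), used to express
-- "equivalent over RCA_0" as: in every (Henkin) model of RCA_0, the model
-- satisfies all instances of one scheme iff it satisfies all instances of the
-- other (equivalent to provability by Goedel completeness).
-- Truth is given by the Goedel-Gentzen (double negation) interpretation so
-- that the object logic is classical.

open import Data.Nat using (ℕ; zero; suc)
open import Data.Fin using (Fin; zero; suc)
open import Data.Product using (Σ; _×_; _,_)
open import Data.Vec.Functional using (Vector; _∷_; [])
open import Relation.Nullary using (¬_)
open import Relation.Binary.PropositionalEquality using (_≡_)

data Term (n : ℕ) : Set where
  var : Fin n → Term n
  `0 `1 : Term n
  _`+_ _`*_ : Term n → Term n → Term n

wk : ∀ {n} → Term n → Term (suc n)
wk (var i) = var (suc i)
wk `0 = `0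
wk `1 = `1
wk (t `+ u) = wk t `+ wk u
wk (t `* u) = wk t `* wk u

data Formula (n m : ℕ) : Set where
  _`=_ _`<_ : Term n → Term n → Formula n m
  _`∈_ : Term n → Fin m → Formula n m
  `¬_ : Formula n m → Formula n m
  _`∧_ _`∨_ _`⇒_ : Formula n m → Formula n m → Formula n m
  `∀ `∃ : Formula (suc n) m → Formula n m
  `∀S `∃S : Formula n (suc m) → Formula n m

data Bounded {n m : ℕ} : Formula n m → Set where
  b= : ∀ t u → Bounded (t `= u)
  b< : ∀ t u → Bounded (t `< u)
  b∈ : ∀ t i → Bounded (t `∈ i)
  b¬ : ∀ {φ} → Bounded φ → Bounded (`¬ φ)
  b∧ : ∀ {φ ψ} → Bounded φ → Bounded ψ → Bounded (φ `∧ ψ)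
  b∨ : ∀ {φ ψ} → Bounded φ → Bounded ψ → Bounded (φ `∨ ψ)
  b⇒ : ∀ {φ ψ} → Bounded φ → Bounded ψ → Bounded (φ `⇒ ψ)
  b∀ : ∀ (t : Term n) {φ} → Bounded {suc n} {m} φ →
       Bounded (`∀ ((var zero `< wk t) `⇒ φ))
  b∃ : ∀ (t : Term n) {φ} → Bounded {suc n} {m} φ →
       Bounded (`∃ ((var zero `< wk t) `∧ φ))

data IsΣ01 {n m : ℕ} : Formula n m → Set where
  σ01 : ∀ {θ} → Bounded {suc n} {m} θ → IsΣ01 (`∃ θ)

data IsΠ01 {n m : ℕ} : Formula n m → Set where
  π01 : ∀ {θ} → Bounded {suc n} {m} θ → IsΠ01 (`∀ θ)

data Arith {n m : ℕ} : Formula n m → Set where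
  a= : ∀ t u → Arith (t `= u)
  a< : ∀ t u → Arith (t `< u)
  a∈ : ∀ t i → Arith (t `∈ i)
  a¬ : ∀ {φ} → Arith φ → Arith (`¬ φ)
  a∧ : ∀ {φ ψ} → Arith φ → Arith ψ → Arith (φ `∧ ψ)
  a∨ : ∀ {φ ψ} → Arith φ → Arith ψ → Arith (φ `∨ ψ)
  a⇒ : ∀ {φ ψ} → Arith φ → Arith ψ → Arith (φ `⇒ ψ)
  a∀ : ∀ {φ} → Arith {suc n} {m} φ → Arith (`∀ φ)
  a∃ : ∀ {φ} → Arith {suc n} {m} φ → Arith (`∃ φ)

data IsΣ11 {n m : ℕ} : Formula n m → Set where
  s-arith : ∀ {φ} → Arith φ → IsΣ11 φ
  s-∃S : ∀ {φ} → IsΣ11 {n} {suc m} φ → IsΣ11 (`∃S φ)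

data ClassChoice : Set where
  Sigma11 Pi10 : ClassChoice

Cls : ClassChoice → ∀ {n m} → Formula n m → Set
Cls Sigma11 = IsΣ11
Cls Pi10 = Arith

record Structure : Set₁ where
  field
    M : Set
    S : Set                 -- second-order part (codes of sets)
    _∈_ : M → S → Set
    zero₀ one₀ : M
    _+_ _*_ : M → M → M
    _<_ : M → M → Set

∃ᶜ : {A : Set} → (A → Set) → Set
∃ᶜ {A} P = ¬ ((a : A) → ¬ P a)

_∨ᶜ_ : Set → Set → Set
A ∨ᶜ B = ¬ (¬ A × ¬ B)

_⇔ᶜ_ : Set → Set → Set
A ⇔ᶜ B = (A → B) × (B → A)

module Semantics (𝔐 : Structure) where
  open Structure 𝔐

  ⟦_⟧ : ∀ {n} → Term n → Vector M n → M
  ⟦ var i ⟧ ρ = ρ i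
  ⟦ `0 ⟧ ρ = zero₀
  ⟦ `1 ⟧ ρ = one₀
  ⟦ t `+ u ⟧ ρ = ⟦ t ⟧ ρ + ⟦ u ⟧ ρ
  ⟦ t `* u ⟧ ρ = ⟦ t ⟧ ρ * ⟦ u ⟧ ρ

  Sat : ∀ {n m} → Formula n m → Vector M n → Vector (M → Set) m → Set
  Sat (t `= u) ρ σ = ¬ ¬ (⟦ t ⟧ ρ ≡ ⟦ u ⟧ ρ)
  Sat (t `< u) ρ σ = ¬ ¬ (⟦ t ⟧ ρ < ⟦ u ⟧ ρ)
  Sat (t `∈ i) ρ σ = ¬ ¬ (σ i (⟦ t ⟧ ρ))
  Sat (`¬ φ) ρ σ = ¬ Sat φ ρ σ
  Sat (φ `∧ ψ) ρ σ = Sat φ ρ σ × Sat ψ ρ σ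
  Sat (φ `∨ ψ) ρ σ = Sat φ ρ σ ∨ᶜ Sat ψ ρ σ
  Sat (φ `⇒ ψ) ρ σ = Sat φ ρ σ → Sat ψ ρ σ
  Sat (`∀ φ) ρ σ = (a : M) → Sat φ (a ∷ ρ) σ
  Sat (`∃ φ) ρ σ = ∃ᶜ (λ (a : M) → Sat φ (a ∷ ρ) σ)
  Sat (`∀S φ) ρ σ = (X : S) → Sat φ ρ ((λ a → a ∈ X) ∷ σ)
  Sat (`∃S φ) ρ σ = ∃ᶜ (λ (X : S) → Sat φ ρ ((λ a → a ∈ X) ∷ σ))

  mem : S → M → Set
  mem X a = a ∈ X

  params : ∀ {m} → Vector S m → Vector (M → Set) m
  params ps i = mem (ps i)

  SetEq : (M → Set) → (M → Set) → Set
  SetEq P Q = (a : M) → (¬ ¬ P a) ⇔ᶜ (¬ ¬ Q a)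

  ⟨_,_⟩ : M → M → M
  ⟨ x , y ⟩ = ((x + y) * (x + y)) + x

  sec : (M → Set) → M → (M → Set)
  sec Y k x = Y ⟨ x , k ⟩

  ini : (M → Set) → M → (M → Set)
  ini Y k z = ∃ᶜ (λ (x : M) → ∃ᶜ (λ (l : M) →
                 (¬ ¬ (z ≡ ⟨ x , l ⟩)) × (¬ ¬ (l < k)) × (¬ ¬ sec Y l x)))

  v0 : ∀ {n} → Term (suc n)
  v0 = var zero
  v1 : ∀ {n} → Term (suc (suc n))
  v1 = var (suc zero)

  -- basic axioms (Simpson, SOSOA Def. I.2.4), as closed sentences.
  -- In  `∀ (`∀ φ)  the outer variable is v1, the inner one v0.
  Sentence : Formula 0 0 → Set
  Sentence φ = Sat φ [] []

  record IsRCA0 : Set₁ where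
    field
      ax-succ≢0 : Sentence (`∀ (`¬ ((v0 `+ `1) `= `0)))
      ax-succ-inj : Sentence (`∀ (`∀ (((v1 `+ `1) `= (v0 `+ `1)) `⇒ (v1 `= v0))))
      ax-+0 : Sentence (`∀ ((v0 `+ `0) `= v0))
      ax-+s : Sentence (`∀ (`∀ ((v1 `+ (v0 `+ `1)) `= ((v1 `+ v0) `+ `1))))
      ax-*0 : Sentence (`∀ ((v0 `* `0) `= `0))
      ax-*s : Sentence (`∀ (`∀ ((v1 `* (v0 `+ `1)) `= ((v1 `* v0) `+ v1))))
      ax-¬<0 : Sentence (`∀ (`¬ (v0 `< `0)))
      ax-<s : Sentence (`∀ (`∀ (((v1 `< (v0 `+ `1)) `⇒ ((v1 `< v0) `∨ (v1 `= v0)))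
                              `∧ (((v1 `< v0) `∨ (v1 `= v0)) `⇒ (v1 `< (v0 `+ `1))))))
      Σ01-ind : ∀ {n m} (φ : Formula (suc n) m) → IsΣ01 φ →
                (ρ : Vector M n) (ps : Vector S m) →
                Sat φ (zero₀ ∷ ρ) (params ps) →
                ((a : M) → Sat φ (a ∷ ρ) (params ps) → Sat φ ((a + one₀) ∷ ρ) (params ps)) →
                (a : M) → Sat φ (a ∷ ρ) (params ps)
      Δ01-CA : ∀ {n m} (φ ψ : Formula (suc n) m) → IsΣ01 φ → IsΠ01 ψ →
               (ρ : Vector M n) (ps : Vector S m) →
               ((a : M) → Sat φ (a ∷ ρ) (params ps) ⇔ᶜ Sat ψ (a ∷ ρ) (params ps)) →
               ∃ᶜ (λ (X : S) → (a : M) → (¬ ¬ (a ∈ X)) ⇔ᶜ Sat φ (a ∷ ρ) (params ps))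

  -- A formula  φ(X,Y)  with parameters is a
  --   Formula n (suc (suc m)),  set variable 0 = Y, set variable 1 = X,
  -- the remaining m set variables and n number variables are parameters.
  -- For scheme (3), ψ(k,X,Y) : Formula (suc n) (suc (suc m)), number var 0 = k.

  Inst : ∀ {n m} → Formula n (suc (suc m)) → Vector M n → Vector S m →
         (X Y : M → Set) → Set
  Inst φ ρ ps X Y = Sat φ ρ (Y ∷ (X ∷ params ps))

  Inst₃ : ∀ {n m} → Formula (suc n) (suc (suc m)) → Vector M n → Vector S m →
          M → (X Y : M → Set) → Set
  Inst₃ ψ ρ ps k X Y = Sat ψ (k ∷ ρ) (Y ∷ (X ∷ params ps))

  ∃!S : ((M → Set) → Set) → Set
  ∃!S P = ∃ᶜ (λ (Y : S) → P (mem Y))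
          × ((Y Y' : S) → P (mem Y) → P (mem Y') → SetEq (mem Y) (mem Y'))

  Scheme1 : (∀ {n m} → Formula n m → Set) → Set
  Scheme1 Γ = ∀ {n m} (φ : Formula n (suc (suc m))) → Γ φ →
              (ρ : Vector M n) (ps : Vector S m) →
              ((X : S) → ∃!S (λ Y → Inst φ ρ ps (mem X) Y)) →
              ∃ᶜ (λ (Y : S) → (k : M) → Inst φ ρ ps (ini (mem Y) k) (sec (mem Y) k))

  Scheme2 : (∀ {n m} → Formula n m → Set) → Set
  Scheme2 Γ = ∀ {n m} (θ : Formula n (suc (suc m))) → Γ θ →
              (ρ : Vector M n) (ps : Vector S m) →
              ((X : S) → ∃!S (λ Y → Inst θ ρ ps (mem X) Y)) →
              (A : S) → ∃ᶜ (λ (Y : S) →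
                 SetEq (sec (mem Y) zero₀) (mem A)
                 × ((k : M) → Inst θ ρ ps (sec (mem Y) k) (sec (mem Y) (k + one₀))))

  Scheme3 : (∀ {n m} → Formula n m → Set) → Set
  Scheme3 Γ = ∀ {n m} (ψ : Formula (suc n) (suc (suc m))) → Γ ψ →
              (ρ : Vector M n) (ps : Vector S m) →
              ((k : M) (X : S) → ∃!S (λ Y → Inst₃ ψ ρ ps k (mem X) Y)) →
              (A : S) → ∃ᶜ (λ (Y : S) →
                 SetEq (sec (mem Y) zero₀) (mem A)
                 × ((k : M) → Inst₃ ψ ρ ps k (sec (mem Y) k) (sec (mem Y) (k + one₀))))

-- Each implication instantiates the assumed scheme with a formula of Γ that encodes the
-- data the target scheme asks for, then decodes the resulting set by Δ⁰₁-comprehension.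
-- Uniqueness of the solutions is what makes the encoding formulas functional again, and
-- Σ⁰₁-induction on bounded formulas identifies the iterates with the intended sets.  For
-- Γ = Σ¹₁ the encoding wraps a Σ¹₁ formula in arithmetical context, and the set-quantifier
-- prefix is moved to the front.  Truth is the double-negation translation, so every
-- argument is classical, run under ¬¬ and discharged by stability.

module Submission where

open import Defs
open import Data.Nat using (ℕ; zero; suc)
open import Data.Fin using (Fin; zero; suc; lift; inject₁)
open import Data.Empty using (⊥-elim)
open import Data.Product using (_×_; _,_; proj₁; proj₂)
open import Data.Vec.Functional using (Vector; _∷_; [])
open import Relation.Nullary using (¬_; yes; no)
open import Relation.Nullary.Negation using (Stable; negated-stable)
open import Relation.Nullary.Decidable using (¬¬-excluded-middle)
open import Relation.Binary.PropositionalEquality using (_≡_; refl; sym; trans; cong; cong₂; subst)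
open import Algebra.Bundles using (CommutativeMonoid)
import Algebra.Solver.CommutativeMonoid as CommutativeMonoidSolver

private variable
  A B C D G : Set

¬¬-return : A → ¬ ¬ A
¬¬-return a k = k a

×-stable : Stable A → Stable B → Stable (A × B)
×-stable sa sb nn = sa (λ k → nn (λ p → k (proj₁ p))) , sb (λ k → nn (λ p → k (proj₂ p)))

Π-stable : {B : A → Set} → ((a : A) → Stable (B a)) → Stable ((a : A) → B a)
Π-stable sb nn a = sb a (λ k → nn (λ f → k (f a)))

→-stable : Stable B → Stable (A → B)
→-stable sb = Π-stable (λ _ → sb)

⇔ᶜ-stable : Stable A → Stable B → Stable (A ⇔ᶜ B)
⇔ᶜ-stable sa sb = ×-stable (→-stable sb) (→-stable sa)

¬¬-elim : Stable G → ¬ ¬ A → (A → G) → G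
¬¬-elim sg na f = sg (λ k → na (λ a → k (f a)))

by-cases : Stable G → (A → G) → (¬ A → G) → G
by-cases sg f g = ¬¬-elim sg ¬¬-excluded-middle λ { (yes a) → f a ; (no ¬a) → g ¬a }

∃ᶜ-intro : {B : A → Set} (a : A) → B a → ∃ᶜ B
∃ᶜ-intro a b k = k a b

∃ᶜ-elim : {B : A → Set} → Stable G → ∃ᶜ B → ((a : A) → B a → G) → G
∃ᶜ-elim sg e f = sg (λ k → e (λ a b → k (f a b)))

∃ᶜ-map : {B C : A → Set} → (∀ a → B a → C a) → ∃ᶜ B → ∃ᶜ C
∃ᶜ-map f e k = e (λ a b → k a (f a b))

∨ᶜ-inj₁ : A → A ∨ᶜ B
∨ᶜ-inj₁ a (¬a , _) = ¬a a

∨ᶜ-inj₂ : B → A ∨ᶜ B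
∨ᶜ-inj₂ b (_ , ¬b) = ¬b b

∨ᶜ-elim : Stable G → A ∨ᶜ B → (A → G) → (B → G) → G
∨ᶜ-elim sg o f g = sg (λ k → o ((λ a → k (f a)) , (λ b → k (g b))))

⇔-refl : A ⇔ᶜ A
⇔-refl = (λ a → a) , (λ a → a)

⇔-sym : A ⇔ᶜ B → B ⇔ᶜ A
⇔-sym (f , g) = g , f

⇔-trans : A ⇔ᶜ B → B ⇔ᶜ C → A ⇔ᶜ C
⇔-trans (f , g) (f' , g') = (λ a → f' (f a)) , (λ c → g (g' c))

¬-cong : A ⇔ᶜ B → (¬ A) ⇔ᶜ (¬ B)
¬-cong (f , g) = (λ na b → na (g b)) , (λ nb a → nb (f a))

¬¬-cong : A ⇔ᶜ B → (¬ ¬ A) ⇔ᶜ (¬ ¬ B)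
¬¬-cong e = ¬-cong (¬-cong e)

×-cong : A ⇔ᶜ B → C ⇔ᶜ D → (A × C) ⇔ᶜ (B × D)
×-cong (f , g) (f' , g') = (λ (a , c) → f a , f' c) , (λ (b , d) → g b , g' d)

→-cong : A ⇔ᶜ B → C ⇔ᶜ D → (A → C) ⇔ᶜ (B → D)
→-cong (f , g) (f' , g') = (λ h b → f' (h (g b))) , (λ h a → g' (h (f a)))

Π-cong : {B C : A → Set} → ((a : A) → B a ⇔ᶜ C a) → ((a : A) → B a) ⇔ᶜ ((a : A) → C a)
Π-cong e = (λ h a → proj₁ (e a) (h a)) , (λ h a → proj₂ (e a) (h a))

∃ᶜ-cong : {B C : A → Set} → ((a : A) → B a ⇔ᶜ C a) → ∃ᶜ B ⇔ᶜ ∃ᶜ C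
∃ᶜ-cong e = ¬-cong (Π-cong (λ a → ¬-cong (e a)))

∨ᶜ-cong : A ⇔ᶜ B → C ⇔ᶜ D → (A ∨ᶜ C) ⇔ᶜ (B ∨ᶜ D)
∨ᶜ-cong e e' = ¬-cong (×-cong (¬-cong e) (¬-cong e'))

∃ᶜ-×ˡ : {T : A → Set} → Stable B → ∃ᶜ (λ a → B × T a) ⇔ᶜ (B × ∃ᶜ T)
∃ᶜ-×ˡ sb = (λ e → ∃ᶜ-elim sb e (λ _ p → proj₁ p) , ∃ᶜ-map (λ _ p → proj₂ p) e) ,
           (λ (b , e) → ∃ᶜ-map (λ _ t → b , t) e)

∃ᶜ-×ʳ : {T : A → Set} → Stable B → ∃ᶜ (λ a → T a × B) ⇔ᶜ (∃ᶜ T × B)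
∃ᶜ-×ʳ sb = (λ e → ∃ᶜ-map (λ _ p → proj₁ p) e , ∃ᶜ-elim sb e (λ _ p → proj₂ p)) ,
           (λ (e , b) → ∃ᶜ-map (λ _ t → t , b) e)

∃ᶜ-∨ᶜʳ : {T : A → Set} → ¬ ¬ A → ∃ᶜ (λ a → T a ∨ᶜ B) ⇔ᶜ (∃ᶜ T ∨ᶜ B)
∃ᶜ-∨ᶜʳ inhabited =
  (λ e → ∃ᶜ-elim negated-stable e (λ a o → ∨ᶜ-elim negated-stable o (λ t → ∨ᶜ-inj₁ (∃ᶜ-intro a t)) ∨ᶜ-inj₂)) ,
  (λ o → ∨ᶜ-elim negated-stable o (∃ᶜ-map (λ _ → ∨ᶜ-inj₁))
           (λ b → ¬¬-elim negated-stable inhabited (λ a → ∃ᶜ-intro a (∨ᶜ-inj₂ b))))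

∃ᶜ-∨ᶜˡ : {T : A → Set} → ¬ ¬ A → ∃ᶜ (λ a → B ∨ᶜ T a) ⇔ᶜ (B ∨ᶜ ∃ᶜ T)
∃ᶜ-∨ᶜˡ inhabited =
  (λ e → ∃ᶜ-elim negated-stable e (λ a o → ∨ᶜ-elim negated-stable o ∨ᶜ-inj₁ (λ t → ∨ᶜ-inj₂ (∃ᶜ-intro a t)))) ,
  (λ o → ∨ᶜ-elim negated-stable o
           (λ b → ¬¬-elim negated-stable inhabited (λ a → ∃ᶜ-intro a (∨ᶜ-inj₁ b)))
           (∃ᶜ-map (λ _ → ∨ᶜ-inj₂)))

∃ᶜ-comm : {T : A → B → Set} → ∃ᶜ (λ a → ∃ᶜ (λ b → T a b)) ⇔ᶜ ∃ᶜ (λ b → ∃ᶜ (λ a → T a b))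
∃ᶜ-comm = (λ e k → e (λ a e' → e' (λ b t → k b (∃ᶜ-intro a t)))) ,
          (λ e k → e (λ b e' → e' (λ a t → k a (∃ᶜ-intro b t))))

renameTerm : ∀ {n n'} → (Fin n → Fin n') → Term n → Term n'
renameTerm r (var i) = var (r i)
renameTerm r `0 = `0
renameTerm r `1 = `1
renameTerm r (t `+ u) = renameTerm r t `+ renameTerm r u
renameTerm r (t `* u) = renameTerm r t `* renameTerm r u

renameTerm-wk : ∀ {n n'} (r : Fin n → Fin n') (t : Term n) →
                renameTerm (lift 1 r) (wk t) ≡ wk (renameTerm r t)
renameTerm-wk r (var i) = refl
renameTerm-wk r `0 = refl
renameTerm-wk r `1 = refl
renameTerm-wk r (t `+ u) = cong₂ _`+_ (renameTerm-wk r t) (renameTerm-wk r u)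
renameTerm-wk r (t `* u) = cong₂ _`*_ (renameTerm-wk r t) (renameTerm-wk r u)

v₀ : ∀ {n} → Term (suc n)
v₀ = var zero

v₁ : ∀ {n} → Term (suc (suc n))
v₁ = var (suc zero)

v₂ : ∀ {n} → Term (suc (suc (suc n)))
v₂ = var (suc (suc zero))

v₃ : ∀ {n} → Term (suc (suc (suc (suc n))))
v₃ = var (suc (suc (suc zero)))

`⟨_,_⟩ : ∀ {n} → Term n → Term n → Term n
`⟨ x , y ⟩ = ((x `+ y) `* (x `+ y)) `+ x

_`⇔_ : ∀ {n m} → Formula n m → Formula n m → Formula n m
φ `⇔ ψ = (φ `⇒ ψ) `∧ (ψ `⇒ φ)

data SetArg (n : ℕ) : Set where
  whole : SetArg n
  section : Term n → SetArg n

wkSetArg : ∀ {n} → SetArg n → SetArg (suc n)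
wkSetArg whole = whole
wkSetArg (section k) = section (wk k)

memberTerm : ∀ {n} → SetArg n → Term n → Term n
memberTerm whole t = t
memberTerm (section k) t = `⟨ t , k ⟩

sub : ∀ {n n' m m'} → (Fin n → Fin n') → (Fin m → Fin m') → (Fin m → SetArg n') →
      Formula n m → Formula n' m'
sub r s c (t `= u) = renameTerm r t `= renameTerm r u
sub r s c (t `< u) = renameTerm r t `< renameTerm r u
sub r s c (t `∈ i) = memberTerm (c i) (renameTerm r t) `∈ s i
sub r s c (`¬ φ) = `¬ sub r s c φ
sub r s c (φ `∧ ψ) = sub r s c φ `∧ sub r s c ψ
sub r s c (φ `∨ ψ) = sub r s c φ `∨ sub r s c ψ
sub r s c (φ `⇒ ψ) = sub r s c φ `⇒ sub r s c ψ
sub r s c (`∀ φ) = `∀ (sub (lift 1 r) s (λ i → wkSetArg (c i)) φ)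
sub r s c (`∃ φ) = `∃ (sub (lift 1 r) s (λ i → wkSetArg (c i)) φ)
sub r s c (`∀S φ) = `∀S (sub r (lift 1 s) (whole ∷ c) φ)
sub r s c (`∃S φ) = `∃S (sub r (lift 1 s) (whole ∷ c) φ)

sub-Arith : ∀ {n n' m m'} (r : Fin n → Fin n') (s : Fin m → Fin m') (c : Fin m → SetArg n') {φ} →
            Arith φ → Arith (sub r s c φ)
sub-Arith r s c (a= t u) = a= _ _
sub-Arith r s c (a< t u) = a< _ _
sub-Arith r s c (a∈ t i) = a∈ _ _
sub-Arith r s c (a¬ p) = a¬ (sub-Arith r s c p)
sub-Arith r s c (a∧ p q) = a∧ (sub-Arith r s c p) (sub-Arith r s c q)
sub-Arith r s c (a∨ p q) = a∨ (sub-Arith r s c p) (sub-Arith r s c q)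
sub-Arith r s c (a⇒ p q) = a⇒ (sub-Arith r s c p) (sub-Arith r s c q)
sub-Arith r s c (a∀ p) = a∀ (sub-Arith _ _ _ p)
sub-Arith r s c (a∃ p) = a∃ (sub-Arith _ _ _ p)

sub-Σ11 : ∀ {n n' m m'} (r : Fin n → Fin n') (s : Fin m → Fin m') (c : Fin m → SetArg n') {φ} →
          IsΣ11 φ → IsΣ11 (sub r s c φ)
sub-Σ11 r s c (s-arith p) = s-arith (sub-Arith r s c p)
sub-Σ11 r s c (s-∃S p) = s-∃S (sub-Σ11 _ _ _ p)

sub-Cls : ∀ cl {n n' m m'} (r : Fin n → Fin n') (s : Fin m → Fin m') (c : Fin m → SetArg n') {φ} →
          Cls cl φ → Cls cl (sub r s c φ)
sub-Cls Sigma11 = sub-Σ11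
sub-Cls Pi10 = sub-Arith

sub-Bounded : ∀ {n n' m m'} (r : Fin n → Fin n') (s : Fin m → Fin m') {φ} →
              Bounded φ → Bounded (sub r s (λ _ → whole) φ)
sub-Bounded r s (b= t u) = b= _ _
sub-Bounded r s (b< t u) = b< _ _
sub-Bounded r s (b∈ t i) = b∈ _ _
sub-Bounded r s (b¬ p) = b¬ (sub-Bounded r s p)
sub-Bounded r s (b∧ p q) = b∧ (sub-Bounded r s p) (sub-Bounded r s q)
sub-Bounded r s (b∨ p q) = b∨ (sub-Bounded r s p) (sub-Bounded r s q)
sub-Bounded r s (b⇒ p q) = b⇒ (sub-Bounded r s p) (sub-Bounded r s q)
sub-Bounded r s (b∀ t {φ} p) =
  subst (λ u → Bounded (`∀ ((v₀ `< u) `⇒ sub (lift 1 r) s (λ _ → whole) φ)))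
        (sym (renameTerm-wk r t)) (b∀ (renameTerm r t) (sub-Bounded (lift 1 r) s p))
sub-Bounded r s (b∃ t {φ} p) =
  subst (λ u → Bounded (`∃ ((v₀ `< u) `∧ sub (lift 1 r) s (λ _ → whole) φ)))
        (sym (renameTerm-wk r t)) (b∃ (renameTerm r t) (sub-Bounded (lift 1 r) s p))

Context : ℕ → ℕ → ℕ → Set
Context nh n m = ∀ {m'} → (Fin m → Fin m') → Formula nh m' → Formula n m'

-- The matrix of θ goes into the context and θ's set-quantifier prefix in front of it, so the
-- result is again Σ¹₁; the renaming handed to the context skips the prefix variables.
prenexWrap : ∀ {nh n m} (θ : Formula nh m) → IsΣ11 θ → Context nh n m → Formula n m
prenexWrap θ (s-arith _) B = B (λ i → i) θ
prenexWrap (`∃S θ) (s-∃S p) B = `∃S (prenexWrap θ p (λ f → B (λ i → f (suc i))))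

ArithContext : ∀ {nh n m} → Context nh n m → Set
ArithContext B = ∀ {m'} (f : Fin _ → Fin m') h → Arith h → Arith (B f h)

prenexWrap-Σ11 : ∀ {nh n m} (θ : Formula nh m) (p : IsΣ11 θ) (B : Context nh n m) →
                 ArithContext B → IsΣ11 (prenexWrap θ p B)
prenexWrap-Σ11 θ (s-arith a) B hB = s-arith (hB _ θ a)
prenexWrap-Σ11 (`∃S θ) (s-∃S p) B hB = s-∃S (prenexWrap-Σ11 θ p _ (λ f h a → hB _ h a))

wrap : ∀ cl {nh n m} (θ : Formula nh m) → Cls cl θ → Context nh n m → Formula n m
wrap Sigma11 θ p B = prenexWrap θ p B
wrap Pi10 θ p B = B (λ i → i) θ

wrap-Cls : ∀ cl {nh n m} (θ : Formula nh m) (p : Cls cl θ) (B : Context nh n m) →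
           ArithContext B → Cls cl (wrap cl θ p B)
wrap-Cls Sigma11 θ p B hB = prenexWrap-Σ11 θ p B hB
wrap-Cls Pi10 θ p B hB = hB _ θ p

module Satisfaction (𝔐 : Structure) where
  open Structure 𝔐
  open Semantics 𝔐

  Sat-stable : ∀ {n m} (φ : Formula n m) ρ σ → Stable (Sat φ ρ σ)
  Sat-stable (t `= u) ρ σ = negated-stable
  Sat-stable (t `< u) ρ σ = negated-stable
  Sat-stable (t `∈ i) ρ σ = negated-stable
  Sat-stable (`¬ φ) ρ σ = negated-stable
  Sat-stable (φ `∧ ψ) ρ σ = ×-stable (Sat-stable φ ρ σ) (Sat-stable ψ ρ σ)
  Sat-stable (φ `∨ ψ) ρ σ = negated-stable
  Sat-stable (φ `⇒ ψ) ρ σ = →-stable (Sat-stable ψ ρ σ)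
  Sat-stable (`∀ φ) ρ σ = Π-stable (λ a → Sat-stable φ (a ∷ ρ) σ)
  Sat-stable (`∃ φ) ρ σ = negated-stable
  Sat-stable (`∀S φ) ρ σ = Π-stable (λ X → Sat-stable φ ρ _)
  Sat-stable (`∃S φ) ρ σ = negated-stable

  SetEq-refl : {P : M → Set} → SetEq P P
  SetEq-refl a = ⇔-refl

  SetEq-sym : {P Q : M → Set} → SetEq P Q → SetEq Q P
  SetEq-sym e a = ⇔-sym (e a)

  SetEq-trans : {P Q R : M → Set} → SetEq P Q → SetEq Q R → SetEq P R
  SetEq-trans e e' a = ⇔-trans (e a) (e' a)

  SetEq-stable : (P Q : M → Set) → Stable (SetEq P Q)
  SetEq-stable P Q = Π-stable (λ a → ⇔ᶜ-stable negated-stable negated-stable)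

  ⟦renameTerm⟧ : ∀ {n n'} (r : Fin n → Fin n') (t : Term n) {ρ : Vector M n} {ρ' : Vector M n'} →
                 (∀ i → ρ i ≡ ρ' (r i)) → ⟦ renameTerm r t ⟧ ρ' ≡ ⟦ t ⟧ ρ
  ⟦renameTerm⟧ r (var i) h = sym (h i)
  ⟦renameTerm⟧ r `0 h = refl
  ⟦renameTerm⟧ r `1 h = refl
  ⟦renameTerm⟧ r (t `+ u) h = cong₂ _+_ (⟦renameTerm⟧ r t h) (⟦renameTerm⟧ r u h)
  ⟦renameTerm⟧ r (t `* u) h = cong₂ _*_ (⟦renameTerm⟧ r t h) (⟦renameTerm⟧ r u h)

  ⟦wk⟧ : ∀ {n} (t : Term n) (a : M) ρ → ⟦ wk t ⟧ (a ∷ ρ) ≡ ⟦ t ⟧ ρ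
  ⟦wk⟧ (var i) a ρ = refl
  ⟦wk⟧ `0 a ρ = refl
  ⟦wk⟧ `1 a ρ = refl
  ⟦wk⟧ (t `+ u) a ρ = cong₂ _+_ (⟦wk⟧ t a ρ) (⟦wk⟧ u a ρ)
  ⟦wk⟧ (t `* u) a ρ = cong₂ _*_ (⟦wk⟧ t a ρ) (⟦wk⟧ u a ρ)

  memberValue : ∀ {n} → SetArg n → Vector M n → M → M
  memberValue whole ρ a = a
  memberValue (section k) ρ a = ⟨ a , ⟦ k ⟧ ρ ⟩

  ⟦memberTerm⟧ : ∀ {n} (c : SetArg n) (t : Term n) ρ → ⟦ memberTerm c t ⟧ ρ ≡ memberValue c ρ (⟦ t ⟧ ρ)
  ⟦memberTerm⟧ whole t ρ = refl
  ⟦memberTerm⟧ (section k) t ρ = refl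

  memberValue-wk : ∀ {n} (c : SetArg n) (a : M) ρ x → memberValue (wkSetArg c) (a ∷ ρ) x ≡ memberValue c ρ x
  memberValue-wk whole a ρ x = refl
  memberValue-wk (section k) a ρ x = cong (λ v → ⟨ x , v ⟩) (⟦wk⟧ k a ρ)

  NumberEnvMatch : ∀ {n n'} → (Fin n → Fin n') → Vector M n → Vector M n' → Set
  NumberEnvMatch r ρ ρ' = ∀ i → ρ i ≡ ρ' (r i)

  SetEnvMatch : ∀ {n' m m'} → (Fin m → Fin m') → (Fin m → SetArg n') →
                Vector M n' → Vector (M → Set) m → Vector (M → Set) m' → Set
  SetEnvMatch s c ρ' σ σ' = ∀ i → SetEq (σ i) (λ a → σ' (s i) (memberValue (c i) ρ' a))

  private
    ≡-subst-⇔ : (P : M → Set) {x y : M} → x ≡ y → P x ⇔ᶜ P y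
    ≡-subst-⇔ P refl = ⇔-refl

    NumberEnvMatch-∷ : ∀ {n n'} {r : Fin n → Fin n'} {ρ ρ'} → NumberEnvMatch r ρ ρ' →
                       ∀ a → NumberEnvMatch (lift 1 r) (a ∷ ρ) (a ∷ ρ')
    NumberEnvMatch-∷ h a zero = refl
    NumberEnvMatch-∷ h a (suc i) = h i

    SetEnvMatch-wk : ∀ {n' m m'} {s : Fin m → Fin m'} {c : Fin m → SetArg n'} {ρ' σ σ'} →
                     SetEnvMatch s c ρ' σ σ' → ∀ a → SetEnvMatch s (λ i → wkSetArg (c i)) (a ∷ ρ') σ σ'
    SetEnvMatch-wk {s = s} {c} {ρ'} {σ' = σ'} h a i x =
      ⇔-trans (h i x) (¬¬-cong (≡-subst-⇔ (σ' (s i)) (sym (memberValue-wk (c i) a ρ' x))))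

    SetEnvMatch-∷ : ∀ {n' m m'} {s : Fin m → Fin m'} {c : Fin m → SetArg n'} {ρ' σ σ'} →
                    SetEnvMatch s c ρ' σ σ' → ∀ P →
                    SetEnvMatch (lift 1 s) (whole ∷ c) ρ' (P ∷ σ) (P ∷ σ')
    SetEnvMatch-∷ h P zero x = ⇔-refl
    SetEnvMatch-∷ h P (suc i) x = h i x

  Sat-sub : ∀ {n n' m m'} (φ : Formula n m) (r : Fin n → Fin n') (s : Fin m → Fin m') (c : Fin m → SetArg n')
            {ρ ρ' σ σ'} → NumberEnvMatch r ρ ρ' → SetEnvMatch s c ρ' σ σ' →
            Sat (sub r s c φ) ρ' σ' ⇔ᶜ Sat φ ρ σ
  Sat-sub (t `= u) r s c {ρ} {ρ'} hr hs =
    ¬¬-cong (⇔-trans (≡-subst-⇔ (λ x → x ≡ ⟦ renameTerm r u ⟧ ρ') (⟦renameTerm⟧ r t hr))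
                     (≡-subst-⇔ (λ y → ⟦ t ⟧ ρ ≡ y) (⟦renameTerm⟧ r u hr)))
  Sat-sub (t `< u) r s c {ρ} {ρ'} hr hs =
    ¬¬-cong (⇔-trans (≡-subst-⇔ (λ x → x < ⟦ renameTerm r u ⟧ ρ') (⟦renameTerm⟧ r t hr))
                     (≡-subst-⇔ (λ y → ⟦ t ⟧ ρ < y) (⟦renameTerm⟧ r u hr)))
  Sat-sub (t `∈ i) r s c {ρ} {ρ'} {σ} {σ'} hr hs =
    ⇔-trans (¬¬-cong (≡-subst-⇔ (σ' (s i)) (⟦memberTerm⟧ (c i) (renameTerm r t) ρ')))
      (⇔-trans (¬¬-cong (≡-subst-⇔ (λ x → σ' (s i) (memberValue (c i) ρ' x)) (⟦renameTerm⟧ r t hr)))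
               (⇔-sym (hs i (⟦ t ⟧ ρ))))
  Sat-sub (`¬ φ) r s c hr hs = ¬-cong (Sat-sub φ r s c hr hs)
  Sat-sub (φ `∧ ψ) r s c hr hs = ×-cong (Sat-sub φ r s c hr hs) (Sat-sub ψ r s c hr hs)
  Sat-sub (φ `∨ ψ) r s c hr hs = ∨ᶜ-cong (Sat-sub φ r s c hr hs) (Sat-sub ψ r s c hr hs)
  Sat-sub (φ `⇒ ψ) r s c hr hs = →-cong (Sat-sub φ r s c hr hs) (Sat-sub ψ r s c hr hs)
  Sat-sub (`∀ φ) r s c {ρ' = ρ'} {σ' = σ'} hr hs =
    Π-cong (λ a → Sat-sub φ (lift 1 r) s _ (NumberEnvMatch-∷ hr a) (SetEnvMatch-wk {c = c} {ρ'} {σ' = σ'} hs a))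
  Sat-sub (`∃ φ) r s c {ρ' = ρ'} {σ' = σ'} hr hs =
    ∃ᶜ-cong (λ a → Sat-sub φ (lift 1 r) s _ (NumberEnvMatch-∷ hr a) (SetEnvMatch-wk {c = c} {ρ'} {σ' = σ'} hs a))
  Sat-sub (`∀S φ) r s c {σ' = σ'} hr hs =
    Π-cong (λ X → Sat-sub φ r (lift 1 s) _ hr (SetEnvMatch-∷ {σ' = σ'} hs (mem X)))
  Sat-sub (`∃S φ) r s c {σ' = σ'} hr hs =
    ∃ᶜ-cong (λ X → Sat-sub φ r (lift 1 s) _ hr (SetEnvMatch-∷ {σ' = σ'} hs (mem X)))

  Sat-cong : ∀ {n m} (φ : Formula n m) {ρ : Vector M n} {σ σ' : Vector (M → Set) m} →
             (∀ i → SetEq (σ i) (σ' i)) → Sat φ ρ σ ⇔ᶜ Sat φ ρ σ'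
  Sat-cong φ {ρ} {σ} {σ'} e =
    ⇔-trans (⇔-sym (Sat-sub φ (λ i → i) (λ i → i) (λ _ → whole) {ρ} {ρ} {σ} {σ} (λ i → refl) (λ i → SetEq-refl)))
            (Sat-sub φ (λ i → i) (λ i → i) (λ _ → whole) (λ i → refl) (λ i → SetEq-sym (e i)))

  Inst-cong : ∀ {n m} (φ : Formula n (suc (suc m))) ρ ps {X X' Y Y' : M → Set} →
              SetEq X X' → SetEq Y Y' → Inst φ ρ ps X Y ⇔ᶜ Inst φ ρ ps X' Y'
  Inst-cong φ ρ ps eX eY = Sat-cong φ λ { zero → eY ; (suc zero) → eX ; (suc (suc i)) → SetEq-refl }

  -- meaning-∃ᶜ is what allows the set-quantifier prefix of θ to be pulled out of the context.
  record Interpretation {nh n m} (B : Context nh n m) (ρ : Vector M n) : Set₁ where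
    field
      meaning : Vector (M → Set) m → (Vector M nh → Set) → Set
      Sat-context : ∀ {m'} (f : Fin m → Fin m') h σ →
                    Sat (B f h) ρ σ ⇔ᶜ meaning (λ i → σ (f i)) (λ ρh → Sat h ρh σ)
      meaning-∃ᶜ : ∀ σ (T : S → Vector M nh → Set) →
                   ∃ᶜ (λ X → meaning σ (T X)) ⇔ᶜ meaning σ (λ ρh → ∃ᶜ (λ X → T X ρh))

  Sat-wrap : ∀ cl {nh n m} (θ : Formula nh m) (p : Cls cl θ) (B : Context nh n m) {ρ} (I : Interpretation B ρ) →
             ∀ σ → Sat (wrap cl θ p B) ρ σ ⇔ᶜ Interpretation.meaning I σ (λ ρh → Sat θ ρh σ)
  Sat-wrap Pi10 θ p B I σ = Interpretation.Sat-context I (λ i → i) θ σ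
  Sat-wrap Sigma11 θ (s-arith _) B I σ = Interpretation.Sat-context I (λ i → i) θ σ
  Sat-wrap Sigma11 (`∃S θ) (s-∃S p) B I σ =
    ⇔-trans (∃ᶜ-cong (λ X → Sat-wrap Sigma11 θ p _ under-∃S (mem X ∷ σ)))
            (meaning-∃ᶜ σ (λ X ρh → Sat θ ρh (mem X ∷ σ)))
    where
      open Interpretation I
      under-∃S : Interpretation (λ f → B (λ i → f (suc i))) _
      under-∃S = record
        { meaning = λ σ₁ → meaning (λ i → σ₁ (suc i))
        ; Sat-context = λ f → Sat-context (λ i → f (suc i))
        ; meaning-∃ᶜ = λ σ₁ → meaning-∃ᶜ (λ i → σ₁ (suc i)) }

module Arithmetic (𝔐 : Structure) (R : Semantics.IsRCA0 𝔐) where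
  open Structure 𝔐
  open Semantics 𝔐
  open Semantics.IsRCA0 R
  open Satisfaction 𝔐

  private
    ∃ᶜ-vacuous : {P : Set} → Stable P → (∃ᶜ (λ (_ : M) → P)) ⇔ᶜ P
    ∃ᶜ-vacuous sp = (λ e → ∃ᶜ-elim sp e (λ _ p → p)) , ∃ᶜ-intro zero₀

    Π-vacuous : {P : Set} → (M → P) ⇔ᶜ P
    Π-vacuous = (λ f → f zero₀) , (λ p _ → p)

    weaken : ∀ {n m} → Formula (suc n) m → Formula (suc (suc n)) m
    weaken B = sub suc (λ i → i) (λ _ → whole) B

    ∃-weaken : ∀ {n m} (B : Formula (suc n) m) a ρ σ → Sat (`∃ (weaken B)) (a ∷ ρ) σ ⇔ᶜ Sat B (a ∷ ρ) σ
    ∃-weaken B a ρ σ =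
      ⇔-trans (∃ᶜ-cong (λ d → Sat-sub B suc (λ i → i) _ (λ i → refl) (λ i → SetEq-refl))) (∃ᶜ-vacuous (Sat-stable B _ _))

    ∀-weaken : ∀ {n m} (B : Formula (suc n) m) a ρ σ → Sat (`∀ (weaken B)) (a ∷ ρ) σ ⇔ᶜ Sat B (a ∷ ρ) σ
    ∀-weaken B a ρ σ =
      ⇔-trans (Π-cong (λ d → Sat-sub B suc (λ i → i) _ (λ i → refl) (λ i → SetEq-refl))) Π-vacuous

  -- A bounded formula is both Σ⁰₁ and Π⁰₁, by a vacuous quantifier.
  bounded-induction : ∀ {n m} (B : Formula (suc n) m) → Bounded B → (ρ : Vector M n) (ps : Vector S m) →
                      Sat B (zero₀ ∷ ρ) (params ps) →
                      (∀ a → Sat B (a ∷ ρ) (params ps) → Sat B ((a + one₀) ∷ ρ) (params ps)) →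
                      ∀ a → Sat B (a ∷ ρ) (params ps)
  bounded-induction B b ρ ps base step a =
    proj₁ (E a) (Σ01-ind (`∃ (weaken B)) (σ01 (sub-Bounded suc (λ i → i) b)) ρ ps (proj₂ (E zero₀) base)
                   (λ a h → proj₂ (E (a + one₀)) (step a (proj₁ (E a) h))) a)
    where
      E : ∀ a → Sat (`∃ (weaken B)) (a ∷ ρ) (params ps) ⇔ᶜ Sat B (a ∷ ρ) (params ps)
      E a = ∃-weaken B a ρ (params ps)

  bounded-comprehension : ∀ {n m} (B : Formula (suc n) m) → Bounded B → (ρ : Vector M n) (ps : Vector S m) →
                          ∃ᶜ (λ (X : S) → (a : M) → (¬ ¬ (a ∈ X)) ⇔ᶜ Sat B (a ∷ ρ) (params ps))
  bounded-comprehension B b ρ ps =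
    ∃ᶜ-map (λ X h a → ⇔-trans (h a) (∃-weaken B a ρ (params ps)))
      (Δ01-CA (`∃ (weaken B)) (`∀ (weaken B))
              (σ01 (sub-Bounded suc (λ i → i) b)) (π01 (sub-Bounded suc (λ i → i) b)) ρ ps
              (λ a → ⇔-trans (∃-weaken B a ρ (params ps)) (⇔-sym (∀-weaken B a ρ (params ps)))))

  infix 4 _≈_
  _≈_ : M → M → Set
  a ≈ b = ¬ ¬ (a ≡ b)

  ≈-refl : {a : M} → a ≈ a
  ≈-refl = ¬¬-return refl

  ≈-sym : {a b : M} → a ≈ b → b ≈ a
  ≈-sym e k = e (λ p → k (sym p))

  ≈-trans : {a b c : M} → a ≈ b → b ≈ c → a ≈ c
  ≈-trans e e' k = e (λ p → e' (λ q → k (trans p q)))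

  ≈-cong : (f : M → M) {a b : M} → a ≈ b → f a ≈ f b
  ≈-cong f e k = e (λ p → k (cong f p))

  ≈-cong₂ : (f : M → M → M) {a b c d : M} → a ≈ b → c ≈ d → f a c ≈ f b d
  ≈-cong₂ f e e' k = e (λ p → e' (λ q → k (cong₂ f p q)))

  ≈-subst : (P : M → Set) {a b : M} → a ≈ b → ¬ ¬ P a → ¬ ¬ P b
  ≈-subst P e h k = e (λ p → h (λ x → k (subst P p x)))

  ≈-subst-⇔ : (P : M → Set) {a b : M} → a ≈ b → (¬ ¬ P a) ⇔ᶜ (¬ ¬ P b)
  ≈-subst-⇔ P e = ≈-subst P e , ≈-subst P (≈-sym e)

  +-identityʳ : ∀ a → a + zero₀ ≈ a
  +-identityʳ = ax-+0

  +-suc : ∀ a b → a + (b + one₀) ≈ (a + b) + one₀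
  +-suc = ax-+s

  +-identityˡ : ∀ a → zero₀ + a ≈ a
  +-identityˡ = bounded-induction ((`0 `+ v₀) `= v₀) (b= _ _) [] [] (+-identityʳ zero₀)
    (λ a h → ≈-trans (+-suc zero₀ a) (≈-cong (_+ one₀) h))

  suc-+ : ∀ a b → (a + one₀) + b ≈ (a + b) + one₀
  suc-+ a = bounded-induction (((v₁ `+ `1) `+ v₀) `= ((v₁ `+ v₀) `+ `1))
                              (b= _ _) (a ∷ []) []
    (≈-trans (+-identityʳ (a + one₀)) (≈-cong (_+ one₀) (≈-sym (+-identityʳ a))))
    (λ b h → ≈-trans (+-suc (a + one₀) b) (≈-trans (≈-cong (_+ one₀) h) (≈-cong (_+ one₀) (≈-sym (+-suc a b)))))

  +-comm : ∀ a b → a + b ≈ b + a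
  +-comm a = bounded-induction ((v₁ `+ v₀) `= (v₀ `+ v₁)) (b= _ _) (a ∷ []) []
    (≈-trans (+-identityʳ a) (≈-sym (+-identityˡ a)))
    (λ b h → ≈-trans (+-suc a b) (≈-trans (≈-cong (_+ one₀) h) (≈-sym (suc-+ b a))))

  +-assoc : ∀ a b c → (a + b) + c ≈ a + (b + c)
  +-assoc a b = bounded-induction (((v₁ `+ v₂) `+ v₀) `=
                                   (v₁ `+ (v₂ `+ v₀))) (b= _ _) (a ∷ b ∷ []) []
    (≈-trans (+-identityʳ (a + b)) (≈-cong (a +_) (≈-sym (+-identityʳ b))))
    (λ c h → ≈-trans (+-suc (a + b) c) (≈-trans (≈-cong (_+ one₀) h)
               (≈-trans (≈-sym (+-suc a (b + c))) (≈-cong (a +_) (≈-sym (+-suc b c))))))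

  +-commutativeMonoid : CommutativeMonoid _ _
  +-commutativeMonoid = record
    { Carrier = M ; _≈_ = _≈_ ; _∙_ = _+_ ; ε = zero₀
    ; isCommutativeMonoid = record
      { isMonoid = record
        { isSemigroup = record
          { isMagma = record { isEquivalence = record { refl = ≈-refl ; sym = ≈-sym ; trans = ≈-trans } ; ∙-cong = ≈-cong₂ _+_ }
          ; assoc = +-assoc }
        ; identity = +-identityˡ , +-identityʳ }
      ; comm = +-comm } }

  module +-Solver = CommutativeMonoidSolver +-commutativeMonoid
  open +-Solver using (_⊕_; _⊜_)

  +-cancelˡ : ∀ a b c → a + b ≈ a + c → b ≈ c
  +-cancelˡ a b c = bounded-induction (((v₀ `+ v₁) `= (v₀ `+ v₂)) `⇒
                                       (v₁ `= v₂))
                                      (b⇒ (b= _ _) (b= _ _)) (b ∷ c ∷ []) []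
     (λ h → ≈-trans (≈-sym (+-identityˡ b)) (≈-trans h (+-identityˡ c)))
     (λ a ih h → ih (ax-succ-inj (a + b) (a + c) (≈-trans (≈-sym (suc-+ a b)) (≈-trans h (suc-+ a c))))) a

  zero-or-suc : ∀ {G : Set} a → Stable G → (a ≈ zero₀ → G) → (∀ p → a ≈ p + one₀ → G) → G
  zero-or-suc a sg z s = ∃ᶜ-elim sg (cases a) (λ p o → ∨ᶜ-elim sg o z (s p))
    where
      cases : ∀ a → ∃ᶜ (λ p → (a ≈ zero₀) ∨ᶜ (a ≈ p + one₀))
      cases = Σ01-ind (`∃ ((v₁ `= `0) `∨ (v₁ `= (v₀ `+ `1))))
                (σ01 (b∨ (b= _ _) (b= _ _))) [] [] (∃ᶜ-intro zero₀ (∨ᶜ-inj₁ ≈-refl))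
                (λ a _ → ∃ᶜ-intro a (∨ᶜ-inj₂ ≈-refl))

  infix 4 _≺_ _≼_ _<ᶜ_
  _≺_ : M → M → Set
  a ≺ b = ∃ᶜ (λ d → a + (d + one₀) ≈ b)

  _≼_ : M → M → Set
  a ≼ b = ∃ᶜ (λ c → a + c ≈ b)

  _<ᶜ_ : M → M → Set
  a <ᶜ b = ¬ ¬ (a < b)

  <ᶜ-suc : ∀ a → a <ᶜ a + one₀
  <ᶜ-suc a = proj₂ (ax-<s a a) (∨ᶜ-inj₂ ≈-refl)

  <ᶜ-step : ∀ {a b} → a <ᶜ b → a <ᶜ b + one₀
  <ᶜ-step {a} {b} h = proj₂ (ax-<s a b) (∨ᶜ-inj₁ h)

  <ᶜ-suc-inv : ∀ {a b} → a <ᶜ b + one₀ → (a <ᶜ b) ∨ᶜ (a ≈ b)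
  <ᶜ-suc-inv {a} {b} = proj₁ (ax-<s a b)

  <ᶜ-+suc : ∀ a d → a <ᶜ a + (d + one₀)
  <ᶜ-+suc a = bounded-induction (v₁ `< (v₁ `+ (v₀ `+ `1))) (b< _ _) (a ∷ []) []
    (≈-subst (a <_) (≈-sym (≈-trans (+-suc a zero₀) (≈-cong (_+ one₀) (+-identityʳ a)))) (<ᶜ-suc a))
    (λ d h → ≈-subst (a <_) (≈-sym (+-suc a (d + one₀))) (<ᶜ-step h))

  ≺⇒<ᶜ : ∀ {a b} → a ≺ b → a <ᶜ b
  ≺⇒<ᶜ {a} h = ∃ᶜ-elim negated-stable h (λ d e → ≈-subst (a <_) e (<ᶜ-+suc a d))

  <ᶜ⇒≺ : ∀ {a b} → a <ᶜ b → a ≺ b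
  <ᶜ⇒≺ {a} {b} = proj₂ (independence-of-premise negated-stable) (Σ01-ind
      (`∃ ((v₂ `< v₁) `⇒ ((v₂ `+ (v₀ `+ `1)) `= v₁)))
      (σ01 (b⇒ (b< _ _) (b= _ _))) (a ∷ []) []
      (proj₁ (independence-of-premise negated-stable) (λ h → ⊥-elim (ax-¬<0 a h)))
      (λ b ih → proj₁ (independence-of-premise negated-stable) (λ h → ∨ᶜ-elim negated-stable (<ᶜ-suc-inv h)
         (λ lt → ∃ᶜ-elim negated-stable (proj₂ (independence-of-premise negated-stable) ih lt) (λ d e →
                   ∃ᶜ-intro (d + one₀) (≈-trans (+-suc a (d + one₀)) (≈-cong (_+ one₀) e))))
         (λ eq → ∃ᶜ-intro zero₀ (≈-trans (+-suc a zero₀) (≈-cong (_+ one₀) (≈-trans (+-identityʳ a) eq)))))) b)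
    where
      independence-of-premise : {P : Set} {Q : M → Set} → Stable P → (P → ∃ᶜ Q) ⇔ᶜ ∃ᶜ (λ d → P → Q d)
      independence-of-premise sp =
        (λ h k → h (sp (λ np → k zero₀ (λ p → ⊥-elim (np p)))) (λ d q → k d (λ _ → q))) ,
        (λ e p k → e (λ d f → k d (f p)))

  ≺-irrefl : ∀ a → ¬ (a ≺ a)
  ≺-irrefl a h = h (λ d e → ax-succ≢0 d (+-cancelˡ a (d + one₀) zero₀ (≈-trans e (≈-sym (+-identityʳ a)))))

  <ᶜ-irrefl : ∀ a → ¬ (a <ᶜ a)
  <ᶜ-irrefl a h = ≺-irrefl a (<ᶜ⇒≺ h)

  ≺-trans : ∀ {a b c} → a ≺ b → b ≺ c → a ≺ c
  ≺-trans {a} h₁ h₂ = ∃ᶜ-elim negated-stable h₁ (λ d e₁ → ∃ᶜ-elim negated-stable h₂ (λ f e₂ →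
    ∃ᶜ-intro (d + (f + one₀))
      (≈-trans (+-Solver.solve 4 (λ a d f o → a ⊕ ((d ⊕ (f ⊕ o)) ⊕ o) ⊜ (a ⊕ (d ⊕ o)) ⊕ (f ⊕ o)) ≈-refl a d f one₀)
               (≈-trans (≈-cong (_+ (f + one₀)) e₁) e₂))))

  ≼-≺-trans : ∀ {a b c} → a ≼ b → b ≺ c → a ≺ c
  ≼-≺-trans {a} h₁ h₂ = ∃ᶜ-elim negated-stable h₁ (λ x e₁ → ∃ᶜ-elim negated-stable h₂ (λ f e₂ →
    ∃ᶜ-intro (x + f)
      (≈-trans (+-Solver.solve 4 (λ a x f o → a ⊕ ((x ⊕ f) ⊕ o) ⊜ (a ⊕ x) ⊕ (f ⊕ o)) ≈-refl a x f one₀)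
               (≈-trans (≈-cong (_+ (f + one₀)) e₁) e₂))))

  ≺-≼-trans : ∀ {a b c} → a ≺ b → b ≼ c → a ≺ c
  ≺-≼-trans {a} h₁ h₂ = ∃ᶜ-elim negated-stable h₁ (λ d e₁ → ∃ᶜ-elim negated-stable h₂ (λ x e₂ →
    ∃ᶜ-intro (d + x)
      (≈-trans (+-Solver.solve 4 (λ a d x o → a ⊕ ((d ⊕ x) ⊕ o) ⊜ (a ⊕ (d ⊕ o)) ⊕ x) ≈-refl a d x one₀)
               (≈-trans (≈-cong (_+ x) e₁) e₂))))

  ≺-respʳ-≈ : ∀ {a b b'} → a ≺ b → b ≈ b' → a ≺ b'
  ≺-respʳ-≈ h e = ∃ᶜ-map (λ d e' → ≈-trans e' e) h

  0<ᶜsuc : ∀ a → zero₀ <ᶜ a + one₀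
  0<ᶜsuc a = ≺⇒<ᶜ (∃ᶜ-intro a (+-identityˡ (a + one₀)))

  ≺⇒suc<ᶜsuc : ∀ {a b} → a ≺ b → a + one₀ <ᶜ b + one₀
  ≺⇒suc<ᶜsuc {a} h = ≺⇒<ᶜ (∃ᶜ-map (λ d e →
    ≈-trans (+-Solver.solve 3 (λ a d o → (a ⊕ o) ⊕ (d ⊕ o) ⊜ (a ⊕ (d ⊕ o)) ⊕ o) ≈-refl a d one₀) (≈-cong (_+ one₀) e)) h)

  ≼⇒<ᶜsuc : ∀ {a b} → a ≼ b → a <ᶜ b + one₀
  ≼⇒<ᶜsuc {a} h = ∃ᶜ-elim negated-stable h (λ c e →
    ≺⇒<ᶜ (∃ᶜ-intro c (≈-trans (+-suc a c) (≈-cong (_+ one₀) e))))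

  1≉0 : ¬ (one₀ ≈ zero₀)
  1≉0 e = ax-succ≢0 zero₀ (≈-trans (+-identityˡ one₀) e)

  ≺-compare : ∀ {G : Set} a b → Stable G → (a ≺ b → G) → (a ≈ b → G) → (b ≺ a → G) → G
  ≺-compare a b sg lt eq gt =
    ∃ᶜ-elim sg (trichotomy a b) (λ d o → ∨ᶜ-elim sg o (λ e → lt (∃ᶜ-intro d e))
                                   (λ o' → ∨ᶜ-elim sg o' eq (λ e → gt (∃ᶜ-intro d e))))
    where
      Trichotomy : M → M → M → Set
      Trichotomy a b d = (a + (d + one₀) ≈ b) ∨ᶜ ((a ≈ b) ∨ᶜ (b + (d + one₀) ≈ a))

      trichotomy : ∀ a b → ∃ᶜ (Trichotomy a b)
      trichotomy a = Σ01-ind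
        (`∃ (((v₂ `+ (v₀ `+ `1)) `= v₁) `∨
             ((v₂ `= v₁) `∨ ((v₁ `+ (v₀ `+ `1)) `= v₂))))
        (σ01 (b∨ (b= _ _) (b∨ (b= _ _) (b= _ _)))) (a ∷ []) []
        (zero-or-suc a negated-stable (λ e → ∃ᶜ-intro zero₀ (∨ᶜ-inj₂ (∨ᶜ-inj₁ e)))
           (λ p e → ∃ᶜ-intro p (∨ᶜ-inj₂ (∨ᶜ-inj₂ (≈-trans (+-identityˡ (p + one₀)) (≈-sym e))))))
        (λ b ih → ∃ᶜ-elim negated-stable ih (λ d o → ∨ᶜ-elim negated-stable o
           (λ e → ∃ᶜ-intro (d + one₀) (∨ᶜ-inj₁ (≈-trans (+-suc a (d + one₀)) (≈-cong (_+ one₀) e))))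
           (λ o' → ∨ᶜ-elim negated-stable o'
             (λ e → ∃ᶜ-intro zero₀ (∨ᶜ-inj₁ (≈-trans (+-suc a zero₀) (≈-cong (_+ one₀) (≈-trans (+-identityʳ a) e)))))
             (λ e → step-below b d e))))
        where
          step-below : ∀ b d → b + (d + one₀) ≈ a → ∃ᶜ (Trichotomy a (b + one₀))
          step-below b d e = zero-or-suc d negated-stable
            (λ d≈0 → ∃ᶜ-intro zero₀ (∨ᶜ-inj₂ (∨ᶜ-inj₁ (≈-trans (≈-sym e) (≈-trans (≈-cong (λ x → b + (x + one₀)) d≈0)
                         (≈-trans (+-suc b zero₀) (≈-cong (_+ one₀) (+-identityʳ b))))))))
            (λ p d≈p+1 → ∃ᶜ-intro p (∨ᶜ-inj₂ (∨ᶜ-inj₂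
              (≈-trans (+-Solver.solve 3 (λ b p o → (b ⊕ o) ⊕ (p ⊕ o) ⊜ b ⊕ ((p ⊕ o) ⊕ o)) ≈-refl b p one₀)
                       (≈-trans (≈-cong (λ x → b + (x + one₀)) (≈-sym d≈p+1)) e)))))

  *-sucˡ : ∀ a b → (a + one₀) * b ≈ (a * b) + b
  *-sucˡ a = bounded-induction (((v₁ `+ `1) `* v₀) `= ((v₁ `* v₀) `+ v₀))
                               (b= _ _) (a ∷ []) []
    (≈-trans (ax-*0 (a + one₀)) (≈-sym (≈-trans (+-identityʳ (a * zero₀)) (ax-*0 a))))
    (λ b h → ≈-trans (ax-*s (a + one₀) b) (≈-trans (≈-cong (_+ (a + one₀)) h)
       (≈-trans (+-Solver.solve 4 (λ ab a b o → (ab ⊕ b) ⊕ (a ⊕ o) ⊜ (ab ⊕ a) ⊕ (b ⊕ o)) ≈-refl (a * b) a b one₀)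
                (≈-cong (_+ (b + one₀)) (≈-sym (ax-*s a b))))))

  square-≺-suc : ∀ t → t * t ≺ (t + one₀) * (t + one₀)
  square-≺-suc t = ∃ᶜ-intro (t + t)
    (≈-trans (+-Solver.solve 3 (λ q t o → q ⊕ ((t ⊕ t) ⊕ o) ⊜ (q ⊕ t) ⊕ (t ⊕ o)) ≈-refl (t * t) t one₀)
             (≈-trans (≈-cong (_+ (t + one₀)) (≈-sym (*-sucˡ t t))) (≈-sym (ax-*s (t + one₀) t))))

  -- The gap between consecutive squares: s² + s < (s + 1)² ≤ (s + d + 1)².
  square+≺square : ∀ s d → (s * s) + s ≺ (s + (d + one₀)) * (s + (d + one₀))
  square+≺square s = Σ01-ind
      (`∃ ((((v₂ `* v₂) `+ v₂) `+ (v₀ `+ `1)) `=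
           ((v₂ `+ (v₁ `+ `1)) `* (v₂ `+ (v₁ `+ `1)))))
      (σ01 (b= _ _)) (s ∷ []) []
      (∃ᶜ-intro s (≈-trans (≈-cong (_+ (s + one₀)) (≈-sym (*-sucˡ s s)))
                    (≈-trans (≈-sym (ax-*s (s + one₀) s)) (≈-cong₂ _*_ (≈-sym s+1) (≈-sym s+1)))))
      (λ d h → ≺-trans h (≺-respʳ-≈ (square-≺-suc (s + (d + one₀)))
                            (≈-cong₂ _*_ (≈-sym (+-suc s (d + one₀))) (≈-sym (+-suc s (d + one₀))))))
    where
      s+1 : s + (zero₀ + one₀) ≈ s + one₀
      s+1 = ≈-trans (+-suc s zero₀) (≈-cong (_+ one₀) (+-identityʳ s))

  ⟨⟩-mono-≺ : ∀ x k x' k' → x + k ≺ x' + k' → ⟨ x , k ⟩ ≺ ⟨ x' , k' ⟩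
  ⟨⟩-mono-≺ x k x' k' h = ∃ᶜ-elim negated-stable h (λ d e →
     ≼-≺-trans {⟨ x , k ⟩} (∃ᶜ-intro k (+-assoc _ x k))
       (≺-≼-trans (≺-respʳ-≈ (square+≺square (x + k) d) (≈-cong₂ _*_ e e)) (∃ᶜ-intro x' ≈-refl)))

  ⟨⟩-injective : ∀ {x k x' k'} → ⟨ x , k ⟩ ≈ ⟨ x' , k' ⟩ → (x ≈ x') × (k ≈ k')
  ⟨⟩-injective {x} {k} {x'} {k'} eq = ≺-compare (x + k) (x' + k') (×-stable negated-stable negated-stable)
    (λ lt → ⊥-elim (≺-irrefl _ (≺-respʳ-≈ (⟨⟩-mono-≺ x k x' k' lt) (≈-sym eq))))
    (λ e → let x≈x' = +-cancelˡ ((x + k) * (x + k)) x x' (≈-trans eq (≈-cong (λ y → (y * y) + x') (≈-sym e)))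
           in x≈x' , +-cancelˡ x k k' (≈-trans e (≈-cong (_+ k') (≈-sym x≈x'))))
    (λ gt → ⊥-elim (≺-irrefl _ (≺-respʳ-≈ (⟨⟩-mono-≺ x' k' x k gt) eq)))

  x≼⟨x,k⟩ : ∀ x k → x ≼ ⟨ x , k ⟩
  x≼⟨x,k⟩ x k = ∃ᶜ-intro ((x + k) * (x + k)) (+-comm x _)

  k≼⟨x,k⟩ : ∀ x k → k ≼ ⟨ x , k ⟩
  k≼⟨x,k⟩ x k = zero-or-suc (x + k) negated-stable
     (λ s≈0 → zero-or-suc k negated-stable
        (λ k≈0 → ∃ᶜ-intro ⟨ x , k ⟩ (≈-trans (≈-cong (_+ ⟨ x , k ⟩) k≈0) (+-identityˡ _)))
        (λ p k≈p+1 → ⊥-elim (ax-succ≢0 (x + p) (≈-trans (≈-sym (+-suc x p)) (≈-trans (≈-cong (x +_) (≈-sym k≈p+1)) s≈0)))))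
     (λ q s≈q+1 → ∃ᶜ-intro (((s * q) + x) + x)
        (≈-trans (+-Solver.solve 4 (λ k sq x o → k ⊕ ((sq ⊕ x) ⊕ x) ⊜ (sq ⊕ (x ⊕ k)) ⊕ x) ≈-refl k (s * q) x one₀)
                 (≈-cong (_+ x) (≈-sym (≈-trans (≈-cong (s *_) s≈q+1) (ax-*s s q))))))
    where
      s : M
      s = x + k

module SetsInRCA0 (𝔐 : Structure) (R : Semantics.IsRCA0 𝔐) where
  open Structure 𝔐
  open Semantics 𝔐
  open Semantics.IsRCA0 R
  open Satisfaction 𝔐
  open Arithmetic 𝔐 R

  Represented : (M → Set) → Set
  Represented P = ∃ᶜ (λ (V : S) → SetEq (mem V) P)

  mem-represented : (X : S) → Represented (mem X)
  mem-represented X = ∃ᶜ-intro X SetEq-refl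

  Represented-sec : ∀ {P} → Represented P → ∀ k → Represented (sec P k)
  Represented-sec rP k = ∃ᶜ-elim negated-stable rP λ V V≐P →
    ∃ᶜ-map (λ W W≐Vₖ → SetEq-trans W≐Vₖ (λ x → V≐P ⟨ x , k ⟩))
           (bounded-comprehension (`⟨ v₀ , v₁ ⟩ `∈ zero) (b∈ _ _) (k ∷ []) (V ∷ []))

  section-represented : (Y : S) (k : M) → Represented (sec (mem Y) k)
  section-represented Y = Represented-sec (mem-represented Y)

  empty-exists : ∃ᶜ (λ (E : S) → (a : M) → ¬ (a ∈ E))
  empty-exists = ∃ᶜ-map (λ E h a a∈E → ax-¬<0 a (proj₁ (h a) (¬¬-return a∈E)))
                        (bounded-comprehension (v₀ `< `0) (b< _ _) [] [])

  singleton-exists : (a : M) → ∃ᶜ (λ (Y : S) → (z : M) → (¬ ¬ (z ∈ Y)) ⇔ᶜ (z ≈ a))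
  singleton-exists a = bounded-comprehension (v₀ `= v₁) (b= _ _) (a ∷ []) []

  ini-bound : ∀ {Y : M → Set} {k x l} → ini Y k ⟨ x , l ⟩ → l <ᶜ k
  ini-bound {k = k} i = ∃ᶜ-elim negated-stable i λ x' e → ∃ᶜ-elim negated-stable e λ l' (eq , l'<k , _) →
    ≈-subst (_< k) (≈-sym (proj₂ (⟨⟩-injective eq))) l'<k

  ini-section : ∀ {Y : M → Set} {k l} → l <ᶜ k → SetEq (sec (ini Y k) l) (sec Y l)
  ini-section {Y} {k} {l} l<k x =
    (λ i → ∃ᶜ-elim negated-stable (negated-stable i) λ x' e → ∃ᶜ-elim negated-stable e λ l' (eq , _ , y) →
             ≈-subst Y (≈-sym eq) y) ,
    (λ y → ¬¬-return (∃ᶜ-intro x (∃ᶜ-intro l (≈-refl , l<k , y))))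

  InColumn : M → M → Set
  InColumn k z = ∃ᶜ (λ x → z ≈ ⟨ x , k ⟩)

  AgreeOffColumn : M → (M → Set) → (M → Set) → Set
  AgreeOffColumn k P Q = (z : M) → ¬ InColumn k z → (¬ ¬ P z) ⇔ᶜ (¬ ¬ Q z)

  x<ᶜ⟨x,k⟩+1 : ∀ {x k z} → z ≈ ⟨ x , k ⟩ → x <ᶜ z + one₀
  x<ᶜ⟨x,k⟩+1 {x} {k} e = ≈-subst (λ y → x < (y + one₀)) (≈-sym e) (≼⇒<ᶜsuc (x≼⟨x,k⟩ x k))

  k<ᶜ⟨x,k⟩+1 : ∀ {x k z} → z ≈ ⟨ x , k ⟩ → k <ᶜ z + one₀
  k<ᶜ⟨x,k⟩+1 {x} {k} e = ≈-subst (λ y → k < (y + one₀)) (≈-sym e) (≼⇒<ᶜsuc (k≼⟨x,k⟩ x k))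

  -- The components of a pair z are below z + 1, so quantifiers over them may be bounded.
  drop-bound-∃ : ∀ z k (P : M → Set) → (∀ x → P x → z ≈ ⟨ x , k ⟩) →
                 ∃ᶜ (λ x → x <ᶜ z + one₀ × P x) ⇔ᶜ ∃ᶜ P
  drop-bound-∃ z k P hb = ∃ᶜ-map (λ x p → proj₂ p) , ∃ᶜ-map (λ x p → x<ᶜ⟨x,k⟩+1 (hb x p) , p)

  drop-bound-∃² : ∀ z (P : M → M → Set) → (∀ x l → P x l → z ≈ ⟨ x , l ⟩) →
                  ∃ᶜ (λ x → x <ᶜ z + one₀ × ∃ᶜ (λ l → l <ᶜ z + one₀ × P x l)) ⇔ᶜ ∃ᶜ (λ x → ∃ᶜ (λ l → P x l))
  drop-bound-∃² z P hb =
    ∃ᶜ-map (λ x p → ∃ᶜ-map (λ l q → proj₂ q) (proj₂ p)) ,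
    ∃ᶜ-map (λ x e → ∃ᶜ-elim negated-stable e (λ l p → x<ᶜ⟨x,k⟩+1 (hb x l p)) ,
                    ∃ᶜ-map (λ l p → k<ᶜ⟨x,k⟩+1 (hb x l p) , p) e)

  -- Only the pairs in Y are specified; sections and ini look at nothing else.
  pair-comprehension : (t : Term 2) (W : S) →
                       ∃ᶜ (λ (Y : S) → (x l : M) → (¬ ¬ (⟨ x , l ⟩ ∈ Y)) ⇔ᶜ (¬ ¬ (⟦ t ⟧ (l ∷ x ∷ []) ∈ W)))
  pair-comprehension t W = ∃ᶜ-map (λ Y h x l → ⇔-trans (h ⟨ x , l ⟩) (decode x l))
                                  (bounded-comprehension Pairs bounded [] (W ∷ []))
    where
      Pairs : Formula 1 1
      Pairs = `∃ ((v₀ `< (v₁ `+ `1)) `∧ `∃ ((v₀ `< (v₂ `+ `1)) `∧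
                ((v₂ `= `⟨ v₁ , v₀ ⟩) `∧ (renameTerm inject₁ t `∈ zero))))

      bounded : Bounded Pairs
      bounded = b∃ (v₀ `+ `1) (b∃ (v₁ `+ `1) (b∧ (b= _ _) (b∈ _ _)))

      ⟦t⟧ : M → M → M
      ⟦t⟧ x l = ⟦ t ⟧ (l ∷ x ∷ [])

      ⟦t⟧-inject₁ : ∀ x l z → ⟦ renameTerm inject₁ t ⟧ (l ∷ x ∷ z ∷ []) ≡ ⟦t⟧ x l
      ⟦t⟧-inject₁ x l z = ⟦renameTerm⟧ inject₁ t λ { zero → refl ; (suc zero) → refl }

      decode : ∀ x l → Sat Pairs (⟨ x , l ⟩ ∷ []) (params (W ∷ [])) ⇔ᶜ (¬ ¬ (⟦t⟧ x l ∈ W))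
      decode x l = ⇔-trans (drop-bound-∃² _ _ (λ x l p → proj₁ p))
        ((λ e → ∃ᶜ-elim negated-stable e (λ x' e' → ∃ᶜ-elim negated-stable e' (λ l' (eq , t∈W) →
            let x≈x' , l≈l' = ⟨⟩-injective eq in
            ¬¬-elim negated-stable x≈x' λ { refl → ¬¬-elim negated-stable l≈l' λ { refl →
              subst (λ u → ¬ ¬ (u ∈ W)) (⟦t⟧-inject₁ x l _) t∈W } }))) ,
         (λ h → ∃ᶜ-intro x (∃ᶜ-intro l (≈-refl , subst (λ u → ¬ ¬ (u ∈ W)) (sym (⟦t⟧-inject₁ x l _)) h))))

  replace-column : (X V : S) (k : M) →
                   ∃ᶜ (λ (Y : S) → SetEq (sec (mem Y) k) (mem V) × AgreeOffColumn k (mem Y) (mem X))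
  replace-column X V k = ∃ᶜ-map (λ Y h → column Y h , off-column Y h)
                                (bounded-comprehension Replace bounded (k ∷ []) (X ∷ V ∷ []))
    where
      Replace : Formula 2 2
      Replace = ((v₀ `∈ zero) `∧ (`¬ `∃ ((v₀ `< (v₁ `+ `1)) `∧ (v₁ `= `⟨ v₀ , v₂ ⟩)))) `∨
                `∃ ((v₀ `< (v₁ `+ `1)) `∧ ((v₁ `= `⟨ v₀ , v₂ ⟩) `∧ (v₀ `∈ suc zero)))

      bounded : Bounded Replace
      bounded = b∨ (b∧ (b∈ _ _) (b¬ (b∃ (v₀ `+ `1) (b= _ _)))) (b∃ (v₀ `+ `1) (b∧ (b= _ _) (b∈ _ _)))

      Replaced : M → Set
      Replaced z = (¬ ¬ (z ∈ X) × ¬ InColumn k z) ∨ᶜ ∃ᶜ (λ x → z ≈ ⟨ x , k ⟩ × ¬ ¬ (x ∈ V))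

      Sat-Replace : ∀ z → Sat Replace (z ∷ k ∷ []) (params (X ∷ V ∷ [])) ⇔ᶜ Replaced z
      Sat-Replace z = ∨ᶜ-cong (×-cong ⇔-refl (¬-cong (drop-bound-∃ z k _ (λ x e → e))))
                              (drop-bound-∃ z k _ (λ x p → proj₁ p))

      module _ (Y : S) (h : (a : M) → (¬ ¬ (a ∈ Y)) ⇔ᶜ Sat Replace (a ∷ k ∷ []) (params (X ∷ V ∷ []))) where
        Y⇔Replaced : ∀ z → (¬ ¬ (z ∈ Y)) ⇔ᶜ Replaced z
        Y⇔Replaced z = ⇔-trans (h z) (Sat-Replace z)

        column : SetEq (sec (mem Y) k) (mem V)
        column x =
          (λ x∈Y → ∨ᶜ-elim negated-stable (proj₁ (Y⇔Replaced _) x∈Y)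
                     (λ (_ , off) → ⊥-elim (off (∃ᶜ-intro x ≈-refl)))
                     (λ e → ∃ᶜ-elim negated-stable e (λ x' (eq , x'∈V) →
                              ≈-subst (_∈ V) (≈-sym (proj₁ (⟨⟩-injective eq))) x'∈V))) ,
          (λ x∈V → proj₂ (Y⇔Replaced _) (∨ᶜ-inj₂ (∃ᶜ-intro x (≈-refl , x∈V))))

        off-column : AgreeOffColumn k (mem Y) (mem X)
        off-column z off =
          (λ z∈Y → ∨ᶜ-elim negated-stable (proj₁ (Y⇔Replaced z) z∈Y) proj₁
                     (λ e → ⊥-elim (off (∃ᶜ-map (λ x p → proj₁ p) e)))) ,
          (λ z∈X → proj₂ (Y⇔Replaced z) (∨ᶜ-inj₁ (z∈X , off)))

  Functional : ∀ {n m} → Formula n (suc (suc m)) → Vector M n → Vector S m → Set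
  Functional φ ρ ps = (X : S) → ∃!S (λ Y → Inst φ ρ ps (mem X) Y)

  module _ {n m} {φ : Formula n (suc (suc m))} {ρ : Vector M n} {ps : Vector S m} (F : Functional φ ρ ps) where
    solution-exists : ∀ {X} → Represented X → ∃ᶜ (λ (V : S) → Inst φ ρ ps X (mem V))
    solution-exists rX = ∃ᶜ-elim negated-stable rX (λ X' X'≐X →
      ∃ᶜ-map (λ V → proj₁ (Inst-cong φ ρ ps X'≐X SetEq-refl)) (proj₁ (F X')))

    solution-unique : ∀ {X Y Y'} → Represented X → Represented Y → Represented Y' →
                      Inst φ ρ ps X Y → Inst φ ρ ps X Y' → SetEq Y Y'
    solution-unique rX rY rY' h h' =
      ∃ᶜ-elim (SetEq-stable _ _) rX λ X₀ X₀≐X → ∃ᶜ-elim (SetEq-stable _ _) rY λ Y₀ Y₀≐Y →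
      ∃ᶜ-elim (SetEq-stable _ _) rY' λ Y₀' Y₀'≐Y' →
        SetEq-trans (SetEq-sym Y₀≐Y) (SetEq-trans
          (proj₂ (F X₀) Y₀ Y₀' (proj₂ (Inst-cong φ ρ ps X₀≐X Y₀≐Y) h) (proj₂ (Inst-cong φ ρ ps X₀≐X Y₀'≐Y') h'))
          Y₀'≐Y')

  S-inhabited : ¬ ¬ S
  S-inhabited k = empty-exists (λ E _ → k E)

  SetEq-from-column : ∀ {k} {P Y Y' : M → Set} → SetEq (sec Y k) (sec Y' k) →
                      AgreeOffColumn k Y P → AgreeOffColumn k Y' P → SetEq Y Y'
  SetEq-from-column {k} {P} {Y} {Y'} e a a' z = by-cases (⇔ᶜ-stable negated-stable negated-stable)
    (λ col → ∃ᶜ-elim (⇔ᶜ-stable negated-stable negated-stable) col (λ x z≈⟨x,k⟩ →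
       ⇔-trans (≈-subst-⇔ Y z≈⟨x,k⟩) (⇔-trans (e x) (⇔-sym (≈-subst-⇔ Y' z≈⟨x,k⟩)))))
    (λ off → ⇔-trans (a z off) (⇔-sym (a' z off)))

  AgreeOffColumn-stable : ∀ k (P Q : M → Set) → Stable (AgreeOffColumn k P Q)
  AgreeOffColumn-stable k P Q = Π-stable λ z → →-stable (⇔ᶜ-stable negated-stable negated-stable)

  ∨ᶜ⇔AgreeOffColumn : ∀ k (P Q : M → Set) →
                      ((z : M) → InColumn k z ∨ᶜ ((¬ ¬ P z) ⇔ᶜ (¬ ¬ Q z))) ⇔ᶜ AgreeOffColumn k P Q
  ∨ᶜ⇔AgreeOffColumn k P Q =
    (λ h z off → ⇔ᶜ-stable negated-stable negated-stable (λ ¬agree → h z (off , ¬agree))) ,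
    (λ agree z (off , ¬agree) → ¬agree (agree z off))

  AgreeOffColumn-singleton : ∀ {k a c} {Y : M → Set} → AgreeOffColumn k Y (_≡ ⟨ a , c ⟩) → ¬ (c ≈ k) →
                             ∀ i → (¬ ¬ Y ⟨ i , c ⟩) ⇔ᶜ (i ≈ a)
  AgreeOffColumn-singleton {k} {a} {c} agree c≉k i =
    ⇔-trans (agree ⟨ i , c ⟩ (λ col → col (λ x e → c≉k (proj₂ (⟨⟩-injective e)))))
            ((λ e → proj₁ (⟨⟩-injective e)) , (λ e → ≈-cong (λ u → ⟨ u , c ⟩) e))

  column-over-singleton : (V : S) (k a : M) →
                          ∃ᶜ (λ (Y : S) → SetEq (sec (mem Y) k) (mem V) × AgreeOffColumn k (mem Y) (_≡ a))
  column-over-singleton V k a =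
    ∃ᶜ-elim negated-stable (singleton-exists a) λ S₁ S₁≐a →
    ∃ᶜ-map (λ Y (column , off) → column , λ z off-z → ⇔-trans (off z off-z) (S₁≐a z)) (replace-column S₁ V k)

module Scheme3⇒Scheme1 (𝔐 : Structure) (R : Semantics.IsRCA0 𝔐) (cl : ClassChoice)
                       (scheme3 : Semantics.Scheme3 𝔐 (Cls cl)) {n m : ℕ}
                       (φ : Formula n (suc (suc m))) (φ∈Γ : Cls cl φ)
                       (ρ : Vector (Structure.M 𝔐) n) (ps : Vector (Structure.S 𝔐) m)
                       (φ-functional : SetsInRCA0.Functional 𝔐 R φ ρ ps) where
  open Structure 𝔐
  open Semantics 𝔐
  open Semantics.IsRCA0 R using (ax-¬<0)
  open Satisfaction 𝔐
  open Arithmetic 𝔐 R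
  open SetsInRCA0 𝔐 R

  φ-on-column : Formula (suc n) (suc (suc m))
  φ-on-column = sub suc (λ i → i) (section (v₀) ∷ (λ _ → whole)) φ

  agrees-off-column : ∀ {m'} → (Fin (suc (suc m)) → Fin m') → Formula (suc n) m'
  agrees-off-column f = `∀ ((`∃ (v₁ `= `⟨ v₀ , v₂ ⟩)) `∨
                            ((v₀ `∈ f zero) `⇔ (v₀ `∈ f (suc zero))))

  ψ : Formula (suc n) (suc (suc m))
  ψ = wrap cl φ-on-column (sub-Cls cl suc (λ i → i) _ φ∈Γ) (λ f h → h `∧ agrees-off-column f)

  ψ∈Γ : Cls cl ψ
  ψ∈Γ = wrap-Cls cl _ _ _ λ f h a →
    a∧ a (a∀ (a∨ (a∃ (a= _ _)) (a∧ (a⇒ (a∈ _ _) (a∈ _ _)) (a⇒ (a∈ _ _) (a∈ _ _)))))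

  Sat-ψ : ∀ k (X Y : M → Set) → Inst₃ ψ ρ ps k X Y ⇔ᶜ (Inst φ ρ ps X (sec Y k) × AgreeOffColumn k Y X)
  Sat-ψ k X Y =
    ⇔-trans (Sat-wrap cl φ-on-column _ _ interpretation (Y ∷ X ∷ params ps))
            (×-cong (Sat-sub φ suc (λ i → i) _ (λ i → refl) λ { zero → SetEq-refl ; (suc i) → SetEq-refl })
                    (∨ᶜ⇔AgreeOffColumn k Y X))
    where
      interpretation : Interpretation (λ f h → h `∧ agrees-off-column f) (k ∷ ρ)
      interpretation = record
        { meaning = λ σ T → T (k ∷ ρ) × Sat (agrees-off-column (λ i → i)) (k ∷ ρ) σ
        ; Sat-context = λ f h σ → ⇔-refl
        ; meaning-∃ᶜ = λ σ T → ∃ᶜ-×ʳ (Sat-stable (agrees-off-column (λ i → i)) (k ∷ ρ) σ) }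

  ψ-functional : ∀ k → Functional ψ (k ∷ ρ) ps
  ψ-functional k X = existence , uniqueness
    where
      existence : ∃ᶜ (λ Y → Inst₃ ψ ρ ps k (mem X) (mem Y))
      existence = ∃ᶜ-elim negated-stable (solution-exists φ-functional (mem-represented X)) λ V φXV →
        ∃ᶜ-map (λ Y (column , off) → proj₂ (Sat-ψ k (mem X) (mem Y))
                                       (proj₁ (Inst-cong φ ρ ps SetEq-refl (SetEq-sym column)) φXV , off))
               (replace-column X V k)

      uniqueness : (Y Y' : S) → Inst₃ ψ ρ ps k (mem X) (mem Y) → Inst₃ ψ ρ ps k (mem X) (mem Y') →
                   SetEq (mem Y) (mem Y')
      uniqueness Y Y' h h' =
        let φY , offY = proj₁ (Sat-ψ k (mem X) (mem Y)) h
            φY' , offY' = proj₁ (Sat-ψ k (mem X) (mem Y')) h'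
        in SetEq-from-column (solution-unique φ-functional (mem-represented X) (section-represented Y k)
                                              (section-represented Y' k) φY φY')
                             offY offY'

  -- W is the ψ-iteration from ∅, so W_k is Y^k for the Y whose l-th column is column l of W_{l+1}.
  module Iteration (W : S) (W₀-empty : ∀ z → ¬ ¬ ¬ (⟨ z , zero₀ ⟩ ∈ W))
                   (W-step : ∀ k → Inst₃ ψ ρ ps k (sec (mem W) k) (sec (mem W) (k + one₀))) where

    Earlier : M → M → Set
    Earlier k z = ∃ᶜ (λ x → ∃ᶜ (λ l → z ≈ ⟨ x , l ⟩ × (l <ᶜ k × ¬ ¬ (⟨ z , l + one₀ ⟩ ∈ W))))

    Invariant : Formula 2 1
    Invariant = (`⟨ v₁ , v₀ ⟩ `∈ zero) `⇔ EarlierF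
      where
        EarlierF : Formula 2 1
        EarlierF = `∃ ((v₀ `< (v₂ `+ `1)) `∧
                       `∃ ((v₀ `< (v₃ `+ `1)) `∧
                           ((v₃ `= `⟨ v₁ , v₀ ⟩) `∧
                            ((v₀ `< v₂) `∧ (`⟨ v₃ , v₀ `+ `1 ⟩ `∈ zero)))))

    Invariant-bounded : Bounded Invariant
    Invariant-bounded = b∧ (b⇒ (b∈ _ _) earlier) (b⇒ earlier (b∈ _ _))
      where earlier = b∃ (v₁ `+ `1) (b∃ (v₂ `+ `1) (b∧ (b= _ _) (b∧ (b< _ _) (b∈ _ _))))

    Sat-Invariant : ∀ k z → Sat Invariant (k ∷ z ∷ []) (params (W ∷ [])) ⇔ᶜ ((¬ ¬ (⟨ z , k ⟩ ∈ W)) ⇔ᶜ Earlier k z)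
    Sat-Invariant k z = ×-cong (→-cong ⇔-refl drop-bounds) (→-cong drop-bounds ⇔-refl)
      where drop-bounds = drop-bound-∃² z _ (λ x l p → proj₁ p)

    Earlier-zero : ∀ z → ¬ Earlier zero₀ z
    Earlier-zero z e = e (λ x e' → e' (λ l (_ , l<0 , _) → ax-¬<0 l l<0))

    Earlier-suc-off : ∀ {k z} → ¬ InColumn k z → Earlier (k + one₀) z ⇔ᶜ Earlier k z
    Earlier-suc-off {k} off =
      ∃ᶜ-cong λ x → ∃ᶜ-cong λ l →
        (λ (z≈ , l<k+1 , w) → z≈ , ∨ᶜ-elim negated-stable (<ᶜ-suc-inv l<k+1) (λ l<k → l<k)
                                           (λ l≈k → ⊥-elim (off (∃ᶜ-intro x (≈-trans z≈ (≈-cong (⟨ x ,_⟩) l≈k))))) , w) ,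
        (λ (z≈ , l<k , w) → z≈ , <ᶜ-step l<k , w)

    W⇔Earlier-suc : ∀ k z → (¬ ¬ (⟨ z , k ⟩ ∈ W)) ⇔ᶜ Earlier k z →
                    (¬ ¬ (⟨ z , k + one₀ ⟩ ∈ W)) ⇔ᶜ Earlier (k + one₀) z
    W⇔Earlier-suc k z ih = by-cases (⇔ᶜ-stable negated-stable negated-stable)
      (λ col → ∃ᶜ-elim (⇔ᶜ-stable negated-stable negated-stable) col λ x z≈⟨x,k⟩ →
         (λ w → ∃ᶜ-intro x (∃ᶜ-intro k (z≈⟨x,k⟩ , <ᶜ-suc k , w))) ,
         (λ e → ∃ᶜ-elim negated-stable e λ x' e' → ∃ᶜ-elim negated-stable e' λ l (z≈⟨x',l⟩ , _ , w) →
            ≈-subst (λ u → ⟨ z , u + one₀ ⟩ ∈ W) (proj₂ (⟨⟩-injective (≈-trans (≈-sym z≈⟨x',l⟩) z≈⟨x,k⟩))) w))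
      (λ off → ⇔-trans (proj₂ (proj₁ (Sat-ψ k _ _) (W-step k)) z off) (⇔-trans ih (⇔-sym (Earlier-suc-off off))))

    W⇔Earlier : ∀ k z → (¬ ¬ (⟨ z , k ⟩ ∈ W)) ⇔ᶜ Earlier k z
    W⇔Earlier k z = proj₁ (Sat-Invariant k z) (bounded-induction Invariant Invariant-bounded (z ∷ []) (W ∷ [])
      (proj₂ (Sat-Invariant zero₀ z) ((λ w → ⊥-elim (W₀-empty z w)) , (λ e → ⊥-elim (Earlier-zero z e))))
      (λ k h → proj₂ (Sat-Invariant (k + one₀) z) (W⇔Earlier-suc k z (proj₁ (Sat-Invariant k z) h))) k)

    module _ (Y : S) (Y-columns : ∀ x l → (¬ ¬ (⟨ x , l ⟩ ∈ Y)) ⇔ᶜ (¬ ¬ (⟨ ⟨ x , l ⟩ , l + one₀ ⟩ ∈ W))) where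
      Earlier⇔ini : ∀ k z → Earlier k z ⇔ᶜ ini (mem Y) k z
      Earlier⇔ini k z = ∃ᶜ-cong λ x → ∃ᶜ-cong λ l →
        (λ (z≈ , l<k , w) → z≈ , l<k , proj₂ (Y-columns x l) (≈-subst (λ u → ⟨ u , l + one₀ ⟩ ∈ W) z≈ w)) ,
        (λ (z≈ , l<k , y) → z≈ , l<k , ≈-subst (λ u → ⟨ u , l + one₀ ⟩ ∈ W) (≈-sym z≈) (proj₁ (Y-columns x l) y))

      W-section≐ini : ∀ k → SetEq (sec (mem W) k) (ini (mem Y) k)
      W-section≐ini k z = ⇔-trans (W⇔Earlier k z) (⇔-trans (Earlier⇔ini k z) (¬¬-return , negated-stable))

      φ-along-Y : ∀ k → Inst φ ρ ps (ini (mem Y) k) (sec (mem Y) k)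
      φ-along-Y k = proj₁ (Inst-cong φ ρ ps (W-section≐ini k) (λ x → ⇔-sym (Y-columns x k)))
                          (proj₁ (proj₁ (Sat-ψ k _ _) (W-step k)))

  scheme1-instance : ∃ᶜ (λ Y → (k : M) → Inst φ ρ ps (ini (mem Y) k) (sec (mem Y) k))
  scheme1-instance =
    ∃ᶜ-elim negated-stable empty-exists λ E E-empty →
    ∃ᶜ-elim negated-stable (scheme3 ψ ψ∈Γ ρ ps ψ-functional E) λ W (W₀≐E , W-step) →
    ∃ᶜ-elim negated-stable (pair-comprehension `⟨ `⟨ v₁ , v₀ ⟩ , v₀ `+ `1 ⟩ W) λ Y Y-columns →
    ∃ᶜ-intro Y (Iteration.φ-along-Y W (λ z w → proj₁ (W₀≐E z) w (E-empty z)) W-step Y Y-columns)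

-- The pair (k, X) is coded by the set X ⊕ {⟨k,1⟩}, with X in column 0; θ maps the code of
-- (k, X) to the code of (k + 1, Y) for the unique Y with ψ(k, X, Y), and anything else to ∅.
module Scheme2⇒Scheme3 (𝔐 : Structure) (R : Semantics.IsRCA0 𝔐) (cl : ClassChoice)
                       (scheme2 : Semantics.Scheme2 𝔐 (Cls cl)) {n m : ℕ}
                       (ψ : Formula (suc n) (suc (suc m))) (ψ∈Γ : Cls cl ψ)
                       (ρ : Vector (Structure.M 𝔐) n) (ps : Vector (Structure.S 𝔐) m)
                       (ψ-functional : ∀ k → SetsInRCA0.Functional 𝔐 R ψ (k ∷ ρ) ps) (A : Structure.S 𝔐) where
  open Structure 𝔐
  open Semantics 𝔐
  open Satisfaction 𝔐
  open Arithmetic 𝔐 R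
  open SetsInRCA0 𝔐 R

  ψ-on-sections : Formula (suc n) (suc (suc m))
  ψ-on-sections = sub (λ i → i) (λ i → i) (section `0 ∷ section `0 ∷ (λ _ → whole)) ψ

  only : ∀ {m'} → (Fin (suc (suc m)) → Fin m') → Formula (suc n) m'
  only f = (`⟨ v₀ , `1 ⟩ `∈ f (suc zero)) `∧
           `∀ ((`⟨ v₀ , `1 ⟩ `∈ f (suc zero)) `⇒ (v₀ `= v₁))

  successor-off-column : ∀ {m'} → (Fin (suc (suc m)) → Fin m') → Formula (suc n) m'
  successor-off-column f = `∀ ((`∃ (v₁ `= `⟨ v₀ , `0 ⟩)) `∨
                               ((v₀ `∈ f zero) `⇔ (v₀ `= `⟨ v₁ `+ `1 , `1 ⟩)))

  malformed : ∀ {m'} → (Fin (suc (suc m)) → Fin m') → Formula n m'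
  malformed f = (`¬ `∃ (only f)) `∧ `∀ (`¬ (v₀ `∈ f zero))

  context : Context (suc n) n (suc (suc m))
  context f h = `∃ (only f `∧ (h `∧ successor-off-column f)) `∨ malformed f

  θ : Formula n (suc (suc m))
  θ = wrap cl ψ-on-sections (sub-Cls cl (λ i → i) (λ i → i) _ ψ∈Γ) context

  θ∈Γ : Cls cl θ
  θ∈Γ = wrap-Cls cl _ _ _ λ f h a →
    a∨ (a∃ (a∧ (only-arith f) (a∧ a (a∀ (a∨ (a∃ (a= _ _)) (a∧ (a⇒ (a∈ _ _) (a= _ _)) (a⇒ (a= _ _) (a∈ _ _))))))))
       (a∧ (a¬ (a∃ (only-arith f))) (a∀ (a¬ (a∈ _ _))))
    where
      only-arith : ∀ {m'} (f : Fin (suc (suc m)) → Fin m') → Arith (only f)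
      only-arith f = a∧ (a∈ _ _) (a∀ (a⇒ (a∈ _ _) (a= _ _)))

  Only : (M → Set) → M → Set
  Only X k = ¬ ¬ X ⟨ k , one₀ ⟩ × ((j : M) → ¬ ¬ X ⟨ j , one₀ ⟩ → j ≈ k)

  Only-unique : ∀ {X k k'} → Only X k → Only X k' → k ≈ k'
  Only-unique (X⟨k,1⟩ , _) (_ , unique') = unique' _ X⟨k,1⟩

  Successor : M → (M → Set) → Set
  Successor k Y = AgreeOffColumn zero₀ Y (_≡ ⟨ k + one₀ , one₀ ⟩)

  Codes : (M → Set) → (M → Set) → Set
  Codes X Y = ∃ᶜ (λ k → Only X k × (Inst₃ ψ ρ ps k (sec X zero₀) (sec Y zero₀) × Successor k Y))

  Malformed : (M → Set) → (M → Set) → Set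
  Malformed X Y = ¬ ∃ᶜ (Only X) × ((z : M) → ¬ ¬ ¬ Y z)

  Sat-θ : ∀ X Y → Inst θ ρ ps X Y ⇔ᶜ (Codes X Y ∨ᶜ Malformed X Y)
  Sat-θ X Y =
    ⇔-trans (Sat-wrap cl ψ-on-sections _ context interpretation (Y ∷ X ∷ params ps))
            (∨ᶜ-cong (∃ᶜ-cong λ k → ×-cong ⇔-refl
                        (×-cong (Sat-sub ψ (λ i → i) (λ i → i) _ (λ i → refl)
                                   λ { zero → SetEq-refl ; (suc zero) → SetEq-refl ; (suc (suc i)) → SetEq-refl })
                                (∨ᶜ⇔AgreeOffColumn zero₀ Y (_≡ ⟨ k + one₀ , one₀ ⟩))))
                     ⇔-refl)
    where
      interpretation : Interpretation context ρ
      interpretation = record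
        { meaning = λ σ T → ∃ᶜ (λ k → Sat (only (λ i → i)) (k ∷ ρ) σ ×
                                        (T (k ∷ ρ) × Sat (successor-off-column (λ i → i)) (k ∷ ρ) σ))
                            ∨ᶜ Sat (malformed (λ i → i)) ρ σ
        ; Sat-context = λ f h σ → ⇔-refl
        ; meaning-∃ᶜ = λ σ T →
            ⇔-trans (∃ᶜ-∨ᶜʳ S-inhabited)
                    (∨ᶜ-cong (⇔-trans ∃ᶜ-comm (∃ᶜ-cong λ k →
                                ⇔-trans (∃ᶜ-×ˡ (Sat-stable (only (λ i → i)) (k ∷ ρ) σ))
                                        (×-cong ⇔-refl (∃ᶜ-×ʳ (Sat-stable (successor-off-column (λ i → i)) (k ∷ ρ) σ)))))
                             ⇔-refl) }

  θ-step : ∀ {X Y k} → Inst θ ρ ps X Y → Only X k → Inst₃ ψ ρ ps k (sec X zero₀) (sec Y zero₀) × Successor k Y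
  θ-step {X} {Y} {k} h only-k = ∨ᶜ-elim goal-stable (proj₁ (Sat-θ X Y) h)
    (λ codes → ∃ᶜ-elim goal-stable codes λ k' (only-k' , step) →
       ¬¬-elim goal-stable (Only-unique {X} only-k only-k') λ { refl → step })
    (λ (¬only , _) → ⊥-elim (¬only (∃ᶜ-intro k only-k)))
    where
      goal-stable = ×-stable (Sat-stable ψ _ _) (AgreeOffColumn-stable _ _ _)

  column₁-subsingleton : ∀ {X Y} → Inst θ ρ ps X Y → ∀ i i' → ¬ ¬ Y ⟨ i , one₀ ⟩ → ¬ ¬ Y ⟨ i' , one₀ ⟩ → i ≈ i'
  column₁-subsingleton {X} {Y} h i i' y y' = ∨ᶜ-elim negated-stable (proj₁ (Sat-θ X Y) h)
    (λ codes → ∃ᶜ-elim negated-stable codes λ k (_ , _ , succ) →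
       let column₁ = AgreeOffColumn-singleton succ (1≉0) in
       ≈-trans (proj₁ (column₁ i) y) (≈-sym (proj₁ (column₁ i') y')))
    (λ (_ , empty) → ⊥-elim (empty _ y))

  θ-functional : Functional θ ρ ps
  θ-functional X = existence , uniqueness
    where
      existence : ∃ᶜ (λ Y → Inst θ ρ ps (mem X) (mem Y))
      existence = by-cases negated-stable
        (λ some-only → ∃ᶜ-elim negated-stable some-only λ k only-k →
           ∃ᶜ-elim negated-stable (solution-exists (ψ-functional k) (section-represented X zero₀)) λ V ψXV →
           ∃ᶜ-map (λ Y (column , succ) → proj₂ (Sat-θ (mem X) (mem Y)) (∨ᶜ-inj₁ (∃ᶜ-intro k
                     (only-k , proj₁ (Inst-cong ψ (k ∷ ρ) ps SetEq-refl (SetEq-sym column)) ψXV , succ))))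
                  (column-over-singleton V zero₀ ⟨ k + one₀ , one₀ ⟩))
        (λ no-only → ∃ᶜ-map (λ E E-empty → proj₂ (Sat-θ (mem X) (mem E))
                                              (∨ᶜ-inj₂ (no-only , λ z ¬¬z∈E → ¬¬z∈E (E-empty z))))
                            empty-exists)

      uniqueness : (Y Y' : S) → Inst θ ρ ps (mem X) (mem Y) → Inst θ ρ ps (mem X) (mem Y') → SetEq (mem Y) (mem Y')
      uniqueness Y Y' h h' = ∨ᶜ-elim (SetEq-stable _ _) (proj₁ (Sat-θ (mem X) (mem Y)) h)
        (λ codes → ∃ᶜ-elim (SetEq-stable _ _) codes λ k (only-k , ψY , succY) →
           let ψY' , succY' = θ-step h' only-k in
           SetEq-from-column (solution-unique (ψ-functional k) (section-represented X zero₀)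
                                (section-represented Y zero₀) (section-represented Y' zero₀) ψY ψY')
                             succY succY')
        (λ (no-only , empty) → ∨ᶜ-elim (SetEq-stable _ _) (proj₁ (Sat-θ (mem X) (mem Y')) h')
           (λ codes → ⊥-elim (no-only (∃ᶜ-map (λ k → proj₁) codes)))
           (λ (_ , empty') z → (λ y → ⊥-elim (empty z y)) , (λ y' → ⊥-elim (empty' z y'))))

  module Iteration (A' : S) (A'₀≐A : SetEq (sec (mem A') zero₀) (mem A))
                   (A'-counter : AgreeOffColumn zero₀ (mem A') (_≡ ⟨ zero₀ , one₀ ⟩))
                   (Z : S) (Z₀≐A' : SetEq (sec (mem Z) zero₀) (mem A'))
                   (Z-step : ∀ k → Inst θ ρ ps (sec (mem Z) k) (sec (mem Z) (k + one₀))) where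

    counter-unique : ∀ k i i' → ¬ ¬ (⟨ ⟨ i , one₀ ⟩ , k ⟩ ∈ Z) → ¬ ¬ (⟨ ⟨ i' , one₀ ⟩ , k ⟩ ∈ Z) → i ≈ i'
    counter-unique k i i' z z' = zero-or-suc k negated-stable
      (λ k≈0 → ≈-trans (in-A' k≈0 i z) (≈-sym (in-A' k≈0 i' z')))
      (λ p k≈p+1 → column₁-subsingleton (Z-step p) i i' (move k≈p+1 z) (move k≈p+1 z'))
      where
        move : ∀ {j u} → k ≈ u → ¬ ¬ (⟨ ⟨ j , one₀ ⟩ , k ⟩ ∈ Z) → ¬ ¬ (⟨ ⟨ j , one₀ ⟩ , u ⟩ ∈ Z)
        move {j} = ≈-subst (λ u → ⟨ ⟨ j , one₀ ⟩ , u ⟩ ∈ Z)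

        in-A' : k ≈ zero₀ → ∀ j → ¬ ¬ (⟨ ⟨ j , one₀ ⟩ , k ⟩ ∈ Z) → j ≈ zero₀
        in-A' k≈0 j zj = proj₁ (AgreeOffColumn-singleton A'-counter 1≉0 j) (proj₁ (Z₀≐A' _) (move k≈0 zj))

    Z-only : ∀ k → ¬ ¬ (⟨ ⟨ k , one₀ ⟩ , k ⟩ ∈ Z) → Only (sec (mem Z) k) k
    Z-only k z = z , λ j zj → counter-unique k j k zj z

    -- Only (Z_k) k is not bounded, so the induction runs on its first component alone.
    counter : ∀ k → ¬ ¬ (⟨ ⟨ k , one₀ ⟩ , k ⟩ ∈ Z)
    counter = bounded-induction (`⟨ `⟨ v₀ , `1 ⟩ , v₀ ⟩ `∈ zero) (b∈ _ _) [] (Z ∷ [])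
      (proj₂ (Z₀≐A' _) (proj₂ (AgreeOffColumn-singleton A'-counter 1≉0 zero₀) ≈-refl))
      (λ k z → proj₂ (AgreeOffColumn-singleton (proj₂ (θ-step (Z-step k) (Z-only k z))) 1≉0 (k + one₀)) ≈-refl)

    ψ-step : ∀ k → Inst₃ ψ ρ ps k (sec (sec (mem Z) k) zero₀) (sec (sec (mem Z) (k + one₀)) zero₀)
    ψ-step k = proj₁ (θ-step (Z-step k) (Z-only k (counter k)))

  scheme3-instance : ∃ᶜ (λ Y → SetEq (sec (mem Y) zero₀) (mem A) ×
                               ((k : M) → Inst₃ ψ ρ ps k (sec (mem Y) k) (sec (mem Y) (k + one₀))))
  scheme3-instance =
    ∃ᶜ-elim negated-stable (column-over-singleton A zero₀ ⟨ zero₀ , one₀ ⟩) λ A' (A'₀≐A , A'-counter) →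
    ∃ᶜ-elim negated-stable (scheme2 θ θ∈Γ ρ ps θ-functional A') λ Z (Z₀≐A' , Z-step) →
    ∃ᶜ-elim negated-stable (pair-comprehension `⟨ `⟨ v₁ , `0 ⟩ , v₀ ⟩ Z) λ Y Y-columns →
    let open Iteration A' A'₀≐A A'-counter Z Z₀≐A' Z-step in
    ∃ᶜ-intro Y ((λ x → ⇔-trans (Y-columns x zero₀) (⇔-trans (Z₀≐A' ⟨ x , zero₀ ⟩) (A'₀≐A x))) ,
                (λ k → proj₁ (Inst-cong ψ (k ∷ ρ) ps (λ x → ⇔-sym (Y-columns x k)) (λ x → ⇔-sym (Y-columns x (k + one₀))))
                             (ψ-step k)))

-- Every column of the sequence Y built by scheme (1) carries the marker ⟨0,0⟩, so the number of
-- columns of Y^k is readable from Y^k; the payload of each column sits in its own column 1.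
module Scheme1⇒Scheme2 (𝔐 : Structure) (R : Semantics.IsRCA0 𝔐) (cl : ClassChoice)
                       (scheme1 : Semantics.Scheme1 𝔐 (Cls cl)) {n m : ℕ}
                       (θ : Formula n (suc (suc m))) (θ∈Γ : Cls cl θ)
                       (ρ : Vector (Structure.M 𝔐) n) (ps : Vector (Structure.S 𝔐) m)
                       (θ-functional : SetsInRCA0.Functional 𝔐 R θ ρ ps) (A : Structure.S 𝔐) where
  open Structure 𝔐
  open Semantics 𝔐
  open Satisfaction 𝔐
  open Arithmetic 𝔐 R
  open SetsInRCA0 𝔐 R

  θ-on-column₁ : Formula n (suc (suc m))
  θ-on-column₁ = sub (λ i → i) (λ i → i) (section `1 ∷ section `1 ∷ (λ _ → whole)) θ

  skip-A : Fin (suc (suc m)) → Fin (suc (suc (suc m)))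
  skip-A zero = zero
  skip-A (suc zero) = suc zero
  skip-A (suc (suc i)) = suc (suc (suc i))

  θ-on-column₁-of-section : Formula (suc n) (suc (suc (suc m)))
  θ-on-column₁-of-section = sub suc skip-A (whole ∷ section (v₀) ∷ (λ _ → whole)) θ-on-column₁

  marked : ∀ {k m'} → (Fin (suc (suc (suc m))) → Fin m') → Term k → Formula k m'
  marked f t = `⟨ `⟨ `0 , `0 ⟩ , t ⟩ `∈ f (suc zero)

  marker-off-column : ∀ {m'} → (Fin (suc (suc (suc m))) → Fin m') → Formula n m'
  marker-off-column f = `∀ ((`∃ (v₁ `= `⟨ v₀ , `1 ⟩)) `∨
                            ((v₀ `∈ f zero) `⇔ (v₀ `= `⟨ `0 , `0 ⟩)))

  length : ∀ {m'} → (Fin (suc (suc (suc m))) → Fin m') → Formula (suc n) m'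
  length f = (`¬ marked f (v₀ `+ `1)) `∧ `∀ ((v₀ `< (v₁ `+ `1)) `⇒ marked f (v₀))

  unmarked : ∀ {m'} → (Fin (suc (suc (suc m))) → Fin m') → Formula n m'
  unmarked f = (`¬ marked f `0) `∧ `∀ ((`⟨ v₀ , `1 ⟩ `∈ f zero) `⇔ (v₀ `∈ f (suc (suc zero))))

  lengthless : ∀ {m'} → (Fin (suc (suc (suc m))) → Fin m') → Formula n m'
  lengthless f = (marked f `0 `∧ (`¬ `∃ (length f))) `∧ `∀ (`¬ (`⟨ v₀ , `1 ⟩ `∈ f zero))

  context : Context (suc n) n (suc (suc (suc m)))
  context f h = marker-off-column f `∧ (unmarked f `∨ (`∃ (length f `∧ h) `∨ lengthless f))

  φ : Formula n (suc (suc (suc m)))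
  φ = wrap cl θ-on-column₁-of-section (sub-Cls cl suc skip-A _ (sub-Cls cl (λ i → i) (λ i → i) _ θ∈Γ)) context

  φ∈Γ : Cls cl φ
  φ∈Γ = wrap-Cls cl _ _ _ λ f h a →
    a∧ (a∀ (a∨ (a∃ (a= _ _)) (a∧ (a⇒ (a∈ _ _) (a= _ _)) (a⇒ (a= _ _) (a∈ _ _)))))
       (a∨ (a∧ (a¬ (a∈ _ _)) (a∀ (a∧ (a⇒ (a∈ _ _) (a∈ _ _)) (a⇒ (a∈ _ _) (a∈ _ _)))))
           (a∨ (a∃ (a∧ (length-arith f) a)) (a∧ (a∧ (a∈ _ _) (a¬ (a∃ (length-arith f)))) (a∀ (a¬ (a∈ _ _))))))
    where
      length-arith : ∀ {m'} (f : Fin (suc (suc (suc m))) → Fin m') → Arith (length f)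
      length-arith f = a∧ (a¬ (a∈ _ _)) (a∀ (a⇒ (a< _ _) (a∈ _ _)))

  ps' : Vector S (suc m)
  ps' = A ∷ ps

  Marked : (M → Set) → M → Set
  Marked X l = ¬ ¬ X ⟨ ⟨ zero₀ , zero₀ ⟩ , l ⟩

  Length : (M → Set) → M → Set
  Length X p = ¬ Marked X (p + one₀) × ((l : M) → l <ᶜ p + one₀ → Marked X l)

  Length-unique : ∀ {X p p'} → Length X p → Length X p' → p ≈ p'
  Length-unique {X} {p} {p'} (unmarked , marked) (unmarked' , marked') = ≺-compare p p' negated-stable
    (λ p≺p' → ⊥-elim (unmarked (marked' (p + one₀) (≺⇒suc<ᶜsuc p≺p'))))
    (λ p≈p' → p≈p')
    (λ p'≺p → ⊥-elim (unmarked' (marked (p' + one₀) (≺⇒suc<ᶜsuc p'≺p))))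

  Length⇒Marked₀ : ∀ {X p} → Length X p → Marked X zero₀
  Length⇒Marked₀ {p = p} (_ , marked) = marked zero₀ (0<ᶜsuc p)

  MarkerOffColumn : (M → Set) → Set
  MarkerOffColumn Y = AgreeOffColumn one₀ Y (_≡ ⟨ zero₀ , zero₀ ⟩)

  Unmarked : (M → Set) → (M → Set) → Set
  Unmarked X Y = ¬ Marked X zero₀ × SetEq (sec Y one₀) (mem A)

  Continues : (M → Set) → (M → Set) → Set
  Continues X Y = ∃ᶜ (λ p → Length X p × Inst θ ρ ps (sec (sec X p) one₀) (sec Y one₀))

  Lengthless : (M → Set) → (M → Set) → Set
  Lengthless X Y = (Marked X zero₀ × ¬ ∃ᶜ (Length X)) × ((x : M) → ¬ ¬ ¬ Y ⟨ x , one₀ ⟩)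

  Sat-φ : ∀ X Y → Inst φ ρ ps' X Y ⇔ᶜ (MarkerOffColumn Y × (Unmarked X Y ∨ᶜ (Continues X Y ∨ᶜ Lengthless X Y)))
  Sat-φ X Y =
    ⇔-trans (Sat-wrap cl θ-on-column₁-of-section _ context interpretation (Y ∷ X ∷ params ps'))
            (×-cong (∨ᶜ⇔AgreeOffColumn one₀ Y (_≡ ⟨ zero₀ , zero₀ ⟩))
                    (∨ᶜ-cong ⇔-refl (∨ᶜ-cong (∃ᶜ-cong λ p → ×-cong ⇔-refl (Sat-θ-payload p)) ⇔-refl)))
    where
      interpretation : Interpretation context ρ
      interpretation = record
        { meaning = λ σ T → Sat (marker-off-column (λ i → i)) ρ σ ×
                            (Sat (unmarked (λ i → i)) ρ σ ∨ᶜ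
                             (∃ᶜ (λ p → Sat (length (λ i → i)) (p ∷ ρ) σ × T (p ∷ ρ)) ∨ᶜ Sat (lengthless (λ i → i)) ρ σ))
        ; Sat-context = λ f h σ → ⇔-refl
        ; meaning-∃ᶜ = λ σ T →
            ⇔-trans (∃ᶜ-×ˡ (Sat-stable (marker-off-column (λ i → i)) ρ σ)) (×-cong ⇔-refl
              (⇔-trans (∃ᶜ-∨ᶜˡ S-inhabited) (∨ᶜ-cong ⇔-refl
                (⇔-trans (∃ᶜ-∨ᶜʳ S-inhabited) (∨ᶜ-cong
                  (⇔-trans ∃ᶜ-comm (∃ᶜ-cong λ p → ∃ᶜ-×ˡ (Sat-stable (length (λ i → i)) (p ∷ ρ) σ)))
                  ⇔-refl))))) }

      Sat-θ-payload : ∀ p → Sat θ-on-column₁-of-section (p ∷ ρ) (Y ∷ X ∷ params ps') ⇔ᶜ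
                            Inst θ ρ ps (sec (sec X p) one₀) (sec Y one₀)
      Sat-θ-payload p =
        ⇔-trans (Sat-sub θ-on-column₁ suc skip-A _ {σ = Y ∷ sec X p ∷ params ps} (λ i → refl)
                   λ { zero → SetEq-refl ; (suc zero) → SetEq-refl ; (suc (suc i)) → SetEq-refl })
                (Sat-sub θ (λ i → i) (λ i → i) _ (λ i → refl)
                   λ { zero → SetEq-refl ; (suc zero) → SetEq-refl ; (suc (suc i)) → SetEq-refl })

  φ-unmarked : ∀ {X Y} → Inst φ ρ ps' X Y → ¬ Marked X zero₀ → SetEq (sec Y one₀) (mem A)
  φ-unmarked {X} {Y} h ¬marked = ∨ᶜ-elim (SetEq-stable _ _) (proj₂ (proj₁ (Sat-φ X Y) h)) proj₂
    (λ o → ∨ᶜ-elim (SetEq-stable _ _) o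
       (λ continues → ⊥-elim (continues λ p (len , _) → ¬marked (Length⇒Marked₀ {X} len)))
       (λ ((marked , _) , _) → ⊥-elim (¬marked marked)))

  φ-continues : ∀ {X Y p} → Inst φ ρ ps' X Y → Length X p → Inst θ ρ ps (sec (sec X p) one₀) (sec Y one₀)
  φ-continues {X} {Y} {p} h len = ∨ᶜ-elim (Sat-stable θ _ _) (proj₂ (proj₁ (Sat-φ X Y) h))
    (λ (¬marked , _) → ⊥-elim (¬marked (Length⇒Marked₀ {X} len)))
    (λ o → ∨ᶜ-elim (Sat-stable θ _ _) o
       (λ continues → ∃ᶜ-elim (Sat-stable θ _ _) continues λ p' (len' , θ-payload) →
          ¬¬-elim (Sat-stable θ _ _) (Length-unique {X} len len') λ { refl → θ-payload })
       (λ ((_ , ¬len) , _) → ⊥-elim (¬len (∃ᶜ-intro p len))))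

  φ-lengthless : ∀ {X Y} → Inst φ ρ ps' X Y → Marked X zero₀ → ¬ ∃ᶜ (Length X) → (x : M) → ¬ ¬ ¬ Y ⟨ x , one₀ ⟩
  φ-lengthless {X} {Y} h marked ¬len = ∨ᶜ-elim (Π-stable λ _ → negated-stable) (proj₂ (proj₁ (Sat-φ X Y) h))
    (λ (¬marked , _) → ⊥-elim (¬marked marked))
    (λ o → ∨ᶜ-elim (Π-stable λ _ → negated-stable) o
       (λ continues → ⊥-elim (continues λ p (len , _) → ¬len (∃ᶜ-intro p len)))
       proj₂)

  φ-functional : Functional φ ρ ps'
  φ-functional X = existence , uniqueness
    where
      Cases : (M → Set) → Set
      Cases Y = Unmarked (mem X) Y ∨ᶜ (Continues (mem X) Y ∨ᶜ Lengthless (mem X) Y)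

      with-column₁ : (V : S) → (∀ {Y} → SetEq (sec (mem Y) one₀) (mem V) → Cases (mem Y)) →
                     ∃ᶜ (λ Y → Inst φ ρ ps' (mem X) (mem Y))
      with-column₁ V cases = ∃ᶜ-map (λ Y (column , off) → proj₂ (Sat-φ (mem X) (mem Y)) (off , cases column))
                                    (column-over-singleton V one₀ ⟨ zero₀ , zero₀ ⟩)

      existence : ∃ᶜ (λ Y → Inst φ ρ ps' (mem X) (mem Y))
      existence = by-cases negated-stable
        (λ marked → by-cases negated-stable
           (λ some-len → ∃ᶜ-elim negated-stable some-len λ p len →
              ∃ᶜ-elim negated-stable (solution-exists θ-functional (Represented-sec (section-represented X p) one₀))
                λ V θV → with-column₁ V λ column → ∨ᶜ-inj₂ (∨ᶜ-inj₁ (∃ᶜ-intro p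
                           (len , proj₁ (Inst-cong θ ρ ps SetEq-refl (SetEq-sym column)) θV))))
           (λ no-len → ∃ᶜ-elim negated-stable empty-exists λ E E-empty →
              with-column₁ E λ column → ∨ᶜ-inj₂ (∨ᶜ-inj₂ ((marked , no-len) , λ x y → proj₁ (column x) y (E-empty x)))))
        (λ ¬marked → with-column₁ A λ column → ∨ᶜ-inj₁ (¬marked , column))

      column₁ : ∀ {Y Y' : S} → Inst φ ρ ps' (mem X) (mem Y) → Inst φ ρ ps' (mem X) (mem Y') →
                SetEq (sec (mem Y) one₀) (sec (mem Y') one₀)
      column₁ {Y} {Y'} h h' = by-cases (SetEq-stable _ _)
        (λ marked → by-cases (SetEq-stable _ _)
           (λ some-len → ∃ᶜ-elim (SetEq-stable _ _) some-len λ p len →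
              solution-unique θ-functional (Represented-sec (section-represented X p) one₀)
                (section-represented Y one₀) (section-represented Y' one₀) (φ-continues h len) (φ-continues h' len))
           (λ no-len x → (λ y → ⊥-elim (φ-lengthless h marked no-len x y)) ,
                         (λ y' → ⊥-elim (φ-lengthless h' marked no-len x y'))))
        (λ ¬marked → SetEq-trans (φ-unmarked h ¬marked) (SetEq-sym (φ-unmarked h' ¬marked)))

      uniqueness : (Y Y' : S) → Inst φ ρ ps' (mem X) (mem Y) → Inst φ ρ ps' (mem X) (mem Y') → SetEq (mem Y) (mem Y')
      uniqueness Y Y' h h' = SetEq-from-column (column₁ h h') (proj₁ (proj₁ (Sat-φ _ _) h)) (proj₁ (proj₁ (Sat-φ _ _) h'))

  module Iteration (Y : S) (φ-along-Y : ∀ k → Inst φ ρ ps' (ini (mem Y) k) (sec (mem Y) k)) where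
    marker : ∀ l → ¬ ¬ (⟨ ⟨ zero₀ , zero₀ ⟩ , l ⟩ ∈ Y)
    marker l = proj₂ (AgreeOffColumn-singleton (proj₁ (proj₁ (Sat-φ _ _) (φ-along-Y l))) 0≉1 zero₀) ≈-refl
      where
        0≉1 : ¬ (zero₀ ≈ one₀)
        0≉1 e = 1≉0 (≈-sym e)

    Marked-ini : ∀ k l → Marked (ini (mem Y) k) l ⇔ᶜ (l <ᶜ k)
    Marked-ini k l = (λ marked → ini-bound {mem Y} (negated-stable marked)) ,
                     (λ l<k → proj₂ (ini-section {mem Y} l<k ⟨ zero₀ , zero₀ ⟩) (marker l))

    Length-ini : ∀ k → Length (ini (mem Y) (k + one₀)) k
    Length-ini k = (λ marked → <ᶜ-irrefl _ (proj₁ (Marked-ini _ _) marked)) , (λ l → proj₂ (Marked-ini _ l))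

    module _ (Z : S) (Z-columns : ∀ x l → (¬ ¬ (⟨ x , l ⟩ ∈ Z)) ⇔ᶜ (¬ ¬ (⟨ ⟨ x , one₀ ⟩ , l ⟩ ∈ Y))) where
      Z₀≐A : SetEq (sec (mem Z) zero₀) (mem A)
      Z₀≐A = SetEq-trans (λ x → Z-columns x zero₀)
                         (φ-unmarked (φ-along-Y zero₀) (λ marked → <ᶜ-irrefl zero₀ (proj₁ (Marked-ini _ _) marked)))

      Z-step : ∀ k → Inst θ ρ ps (sec (mem Z) k) (sec (mem Z) (k + one₀))
      Z-step k = proj₁ (Inst-cong θ ρ ps (λ x → ⇔-trans (ini-section {mem Y} (<ᶜ-suc k) ⟨ x , one₀ ⟩) (⇔-sym (Z-columns x k)))
                                         (λ x → ⇔-sym (Z-columns x (k + one₀))))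
                       (φ-continues {ini (mem Y) (k + one₀)} (φ-along-Y (k + one₀)) (Length-ini k))

  scheme2-instance : ∃ᶜ (λ Z → SetEq (sec (mem Z) zero₀) (mem A) ×
                               ((k : M) → Inst θ ρ ps (sec (mem Z) k) (sec (mem Z) (k + one₀))))
  scheme2-instance =
    ∃ᶜ-elim negated-stable (scheme1 φ φ∈Γ ρ ps' φ-functional) λ Y φ-along-Y →
    ∃ᶜ-map (λ Z Z-columns → Iteration.Z₀≐A Y φ-along-Y Z Z-columns , Iteration.Z-step Y φ-along-Y Z Z-columns)
           (pair-comprehension `⟨ `⟨ v₁ , `1 ⟩ , v₀ ⟩ Y)

mainTheorem4 : (c : ClassChoice) (𝔐 : Structure) →
    Semantics.IsRCA0 𝔐 →
    ((Semantics.Scheme1 𝔐 (Cls c) → Semantics.Scheme2 𝔐 (Cls c))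
     × (Semantics.Scheme2 𝔐 (Cls c) → Semantics.Scheme3 𝔐 (Cls c))
     × (Semantics.Scheme3 𝔐 (Cls c) → Semantics.Scheme1 𝔐 (Cls c)))
mainTheorem4 c 𝔐 R =
  (λ scheme1 θ θ∈Γ ρ ps θ-functional A → Scheme1⇒Scheme2.scheme2-instance 𝔐 R c scheme1 θ θ∈Γ ρ ps θ-functional A) ,
  (λ scheme2 ψ ψ∈Γ ρ ps ψ-functional A → Scheme2⇒Scheme3.scheme3-instance 𝔐 R c scheme2 ψ ψ∈Γ ρ ps ψ-functional A) ,
  (λ scheme3 φ φ∈Γ ρ ps φ-functional → Scheme3⇒Scheme1.scheme1-instance 𝔐 R c scheme3 φ φ∈Γ ρ ps φ-functional)
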